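{- Let $\mathcal{D}$ be a binary $q$-analog of the Fano plane (a set of $3$-dimensional subspaces of $\mathbb{F}_2^7$ such that every $2$-dimensional subspace is contained in exactly one member of $\mathcal{D}$). If $\mathcal{D}$ is invariant under a subgroup $G\le\mathrm{GL}(7,2)$ of order $3$, then $G$ is conjugate in $\mathrm{GL}(7,2)$ to one of the cyclic groups generated by \[\begin{pmatrix}0&1&0&0&0&0&0\\1&1&0&0&0&0&0\\0&0&0&1&0&0&0\\0&0&1&1&0&0&0\\0&0&0&0&0&1&0\\0&0&0&0&1&1&0\\0&0&0&0&0&0&1\end{pmatrix} \quad\text{or}\quad \begin{pmatrix}0&1&0&0&0&0&0\\1&1&0&0&0&0&0\\0&0&0&1&0&0&0\\0&0&1&1&0&0&0\\0&0&0&0&1&0&0\\0&0&0&0&0&1&0\\0&0&0&0&0&0&1\end{pmatrix}.\]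
   Context: Vectors are row vectors; $A\in\mathrm{GL}(7,2)$ acts on subspaces by $U\mapsto UA=\{\mathbf{u}A:\mathbf{u}\in U\}$ and on sets of subspaces elementwise. $\mathcal{D}$ is $G$-invariant if $\{BA:B\in\mathcal{D}\}=\mathcal{D}$ for all $A\in G$. -}

module Defs where

open import Data.Bool using (Bool; true; false; _∧_; _xor_)
open import Data.Nat using (ℕ; zero; suc)
open import Data.Fin using (Fin)
open import Data.Fin.Properties using () renaming (_≟_ to _≟ᶠ_)
open import Data.Vec using (Vec; []; _∷_; replicate; zipWith; map; tabulate)
open import Data.Product using (Σ; ∃; _×_; _,_)
open import Data.Sum using (_⊎_)
open import Relation.Nullary.Decidable using (⌊_⌋)
open import Relation.Binary.PropositionalEquality using (_≡_; _≢_)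
open import Function.Bundles using (_⇔_)

-- The field F_2 is Bool with xor as addition and ∧ as multiplication.
F2 : Set
F2 = Bool

V : Set
V = Vec F2 7

zeroV : V
zeroV = replicate 7 false

_⊕_ : V → V → V
_⊕_ = zipWith _xor_

scale : F2 → V → V
scale a = map (a ∧_)

lincomb : ∀ {k} → Vec F2 k → Vec V k → V
lincomb []       []       = zeroV
lincomb (c ∷ cs) (b ∷ bs) = scale c b ⊕ lincomb cs bs

-- 7×7 matrices over F_2, given as the list of their rows.
Mat : Set
Mat = Vec V 7

_·_ : V → Mat → V
u · A = lincomb u A

_*_ : Mat → Mat → Mat
A * B = map (_· B) A

I : Mat
I = tabulate (λ i → tabulate (λ j → ⌊ i ≟ᶠ j ⌋))

_^ᴹ_ : Mat → ℕ → Mat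
A ^ᴹ zero  = I
A ^ᴹ suc n = A * (A ^ᴹ n)

Invertible : Mat → Set
Invertible A = Σ Mat λ B → (A * B ≡ I) × (B * A ≡ I)

Subset : Set₁
Subset = V → Set

_≐_ : Subset → Subset → Set
S ≐ T = ∀ u → S u ⇔ T u

_⊆_ : Subset → Subset → Set
S ⊆ T = ∀ u → S u → T u

InSpan : ∀ {k} → Vec V k → Subset
InSpan b u = ∃ λ c → lincomb c b ≡ u

LinIndep : ∀ {k} → Vec V k → Set
LinIndep {k} b = ∀ c → lincomb c b ≡ zeroV → c ≡ replicate k false

HasDim : Subset → ℕ → Set
HasDim S k = Σ (Vec V k) λ b → LinIndep b × (S ≐ InSpan b)

_▷_ : Subset → Mat → Subset
(S ▷ A) w = ∃ λ u → S u × (u · A ≡ w)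

-- D is a predicate on subsets; being a *set of subspaces* it must respect
-- extensional equality of subsets.

IsQFano : (Subset → Set) → Set₁
IsQFano D =
  (∀ S S′ → S ≐ S′ → D S → D S′) ×
  (∀ S → D S → HasDim S 3) ×
  (∀ T → HasDim T 2 →
     Σ Subset λ S → D S × T ⊆ S × (∀ S′ → D S′ → T ⊆ S′ → S′ ≐ S))

Invariant : (Subset → Set) → Mat → Set₁
Invariant D A = ∀ T → D T ⇔ (Σ Subset λ B → D B × (T ≐ (B ▷ A)))

IsSubgroupGL : (Mat → Set) → Set
IsSubgroupGL G =
  (∀ A → G A → Invertible A) ×
  G I ×
  (∀ A B → G A → G B → G (A * B)) ×
  (∀ A → G A → Σ Mat λ B → G B × (A * B ≡ I))

HasOrder3 : (Mat → Set) → Set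
HasOrder3 G = Σ Mat λ X → Σ Mat λ Y → Σ Mat λ Z →
  (X ≢ Y) × (X ≢ Z) × (Y ≢ Z) × G X × G Y × G Z ×
  (∀ A → G A → (A ≡ X) ⊎ (A ≡ Y) ⊎ (A ≡ Z))

ConjugateToCyclic : (Mat → Set) → Mat → Mat → Mat → Set
ConjugateToCyclic G M P Q = ∀ X → G X ⇔ (∃ λ k → X ≡ Q * ((M ^ᴹ k) * P))

M₁ : Mat
M₁ = (false ∷ true  ∷ false ∷ false ∷ false ∷ false ∷ false ∷ []) ∷
     (true  ∷ true  ∷ false ∷ false ∷ false ∷ false ∷ false ∷ []) ∷
     (false ∷ false ∷ false ∷ true  ∷ false ∷ false ∷ false ∷ []) ∷
     (false ∷ false ∷ true  ∷ true  ∷ false ∷ false ∷ false ∷ []) ∷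
     (false ∷ false ∷ false ∷ false ∷ false ∷ true  ∷ false ∷ []) ∷
     (false ∷ false ∷ false ∷ false ∷ true  ∷ true  ∷ false ∷ []) ∷
     (false ∷ false ∷ false ∷ false ∷ false ∷ false ∷ true  ∷ []) ∷ []

M₂ : Mat
M₂ = (false ∷ true  ∷ false ∷ false ∷ false ∷ false ∷ false ∷ []) ∷
     (true  ∷ true  ∷ false ∷ false ∷ false ∷ false ∷ false ∷ []) ∷
     (false ∷ false ∷ false ∷ true  ∷ false ∷ false ∷ false ∷ []) ∷
     (false ∷ false ∷ true  ∷ true  ∷ false ∷ false ∷ false ∷ []) ∷
     (false ∷ false ∷ false ∷ false ∷ true  ∷ false ∷ false ∷ []) ∷
     (false ∷ false ∷ false ∷ false ∷ false ∷ true  ∷ false ∷ []) ∷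
     (false ∷ false ∷ false ∷ false ∷ false ∷ false ∷ true  ∷ []) ∷ []

module Submission where

-- An element A of order 3 in GL(7,2) satisfies (1 + A)(1 + A + A²) = 0, so F₂⁷ is the direct sum of the
-- fixed space of A and the kernel of its norm 1 + A + A², on which A acts through pairs v, v·A with
-- v·A² = v ⊕ v·A. A basis adapted to this splitting exhibits A as M₁, M₂ or M₃ below, with three, two or
-- one such pairs (none would force A = I).
--
-- M₃ cannot preserve a q-Fano plane. Its fixed space F has dimension 5, and a block through a line of F
-- is mapped by A to a block through the same line, hence to itself, which forces it into F. Let H be a
-- hyperplane of F. Through every nonzero q ∈ H some block lies inside H: otherwise five blocks through
-- q and five different lines of H would each contain four points of F ∖ H, twenty distinct points in a
-- set of sixteen. Two blocks inside the 4-dimensional H share a line and therefore coincide, so a single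
-- block would contain all of H.

open import Defs
open import Data.Bool using (Bool; true; false; _∧_; _xor_)
open import Data.Bool.Properties
  using (xor-assoc; xor-comm; xor-identityˡ; xor-identityʳ; xor-same; ∧-distribʳ-xor)
  renaming (_≟_ to _≟ᵇ_)
open import Data.Nat using (ℕ; zero; suc; _+_; _∸_; _^_; _≤_; s≤s; z≤n) renaming (_*_ to _*ℕ_)
import Data.Nat.Properties as ℕ
open import Data.Fin using (Fin; zero; suc; #_; combine; remQuot)
import Data.Fin.Properties as Fin
open import Data.Vec
  using (Vec; []; _∷_; replicate; zipWith; map; lookup; tabulate; _++_; take; drop; splitAt; insertAt; removeAt)
import Data.Vec.Properties as Vec
open import Data.Vec.Relation.Unary.All as All using (All; []; _∷_)
open import Data.Vec.Relation.Unary.All.Properties using (lookup⁺; lookup⁻; map⁺; ++⁺)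
open import Data.Product using (Σ; ∃; _×_; _,_; proj₁; proj₂)
open import Data.Sum using (_⊎_; inj₁; inj₂)
open import Data.Empty using (⊥; ⊥-elim)
open import Function using (_∘_)
open import Function.Bundles using (_⇔_; mk⇔; Equivalence)
open import Relation.Nullary using (¬_; Dec; yes; no)
open import Relation.Nullary.Decidable
  using (⌊_⌋; True; toWitness; toWitnessFalse; map′; _×-dec_; _⊎-dec_; _→-dec_; ¬?; decidable-stable)
open import Relation.Binary.PropositionalEquality

-- Vectors and matrices over F₂

infixl 6 _⊕ₙ_

_⊕ₙ_ : ∀ {n} → Vec Bool n → Vec Bool n → Vec Bool n
_⊕ₙ_ = zipWith _xor_

zeros : ∀ n → Vec Bool n
zeros n = replicate n false

⊕-assoc : ∀ {n} (u v w : Vec Bool n) → (u ⊕ₙ v) ⊕ₙ w ≡ u ⊕ₙ (v ⊕ₙ w)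
⊕-assoc = Vec.zipWith-assoc xor-assoc

⊕-comm : ∀ {n} (u v : Vec Bool n) → u ⊕ₙ v ≡ v ⊕ₙ u
⊕-comm = Vec.zipWith-comm xor-comm

⊕-identityˡ : ∀ {n} (u : Vec Bool n) → zeros n ⊕ₙ u ≡ u
⊕-identityˡ = Vec.zipWith-identityˡ xor-identityˡ

⊕-identityʳ : ∀ {n} (u : Vec Bool n) → u ⊕ₙ zeros n ≡ u
⊕-identityʳ = Vec.zipWith-identityʳ xor-identityʳ

⊕-self : ∀ {n} (u : Vec Bool n) → u ⊕ₙ u ≡ zeros n
⊕-self []      = refl
⊕-self (x ∷ u) = cong₂ _∷_ (xor-same x) (⊕-self u)

⊕-interchange : ∀ {n} (a b c d : Vec Bool n) → (a ⊕ₙ b) ⊕ₙ (c ⊕ₙ d) ≡ (a ⊕ₙ c) ⊕ₙ (b ⊕ₙ d)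
⊕-interchange a b c d = begin
  (a ⊕ₙ b) ⊕ₙ (c ⊕ₙ d) ≡⟨ ⊕-assoc a b (c ⊕ₙ d) ⟩
  a ⊕ₙ (b ⊕ₙ (c ⊕ₙ d)) ≡⟨ cong (a ⊕ₙ_) (sym (⊕-assoc b c d)) ⟩
  a ⊕ₙ ((b ⊕ₙ c) ⊕ₙ d) ≡⟨ cong (λ t → a ⊕ₙ (t ⊕ₙ d)) (⊕-comm b c) ⟩
  a ⊕ₙ ((c ⊕ₙ b) ⊕ₙ d) ≡⟨ cong (a ⊕ₙ_) (⊕-assoc c b d) ⟩
  a ⊕ₙ (c ⊕ₙ (b ⊕ₙ d)) ≡⟨ sym (⊕-assoc a c (b ⊕ₙ d)) ⟩
  (a ⊕ₙ c) ⊕ₙ (b ⊕ₙ d) ∎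
  where open ≡-Reasoning

⊕-moveˡ : ∀ {n} {u s v : Vec Bool n} → u ⊕ₙ s ≡ v → s ≡ u ⊕ₙ v
⊕-moveˡ {u = u} {s} refl = begin
  s                 ≡⟨ sym (⊕-identityˡ s) ⟩
  zeros _ ⊕ₙ s      ≡⟨ cong (_⊕ₙ s) (sym (⊕-self u)) ⟩
  (u ⊕ₙ u) ⊕ₙ s     ≡⟨ ⊕-assoc u u s ⟩
  u ⊕ₙ (u ⊕ₙ s)     ∎
  where open ≡-Reasoning

⊕≡zeros⇒≡ : ∀ {n} (u v : Vec Bool n) → u ⊕ₙ v ≡ zeros n → u ≡ v
⊕≡zeros⇒≡ u v eq = sym (trans (⊕-moveˡ eq) (⊕-identityʳ u))

⊕-cancelˡ : ∀ {n} (z : Vec Bool n) {x y} → z ⊕ₙ x ≡ z ⊕ₙ y → x ≡ y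
⊕-cancelˡ z eq = trans (⊕-moveˡ eq) (sym (⊕-moveˡ refl))

≡-by-lookup : ∀ {a} {A : Set a} {n} {u v : Vec A n} → (∀ i → lookup u i ≡ lookup v i) → u ≡ v
≡-by-lookup {u = u} {v} h =
  trans (sym (Vec.tabulate∘lookup u)) (trans (Vec.tabulate-cong h) (Vec.tabulate∘lookup v))

scale-true : ∀ u → scale true u ≡ u
scale-true = Vec.map-id

scale-false : ∀ u → scale false u ≡ zeroV
scale-false u = Vec.map-const u false

scale-true-⊕ : ∀ u v → scale true u ⊕ v ≡ u ⊕ v
scale-true-⊕ u v = cong (_⊕ v) (scale-true u)

scale-false-⊕ : ∀ u v → scale false u ⊕ v ≡ v
scale-false-⊕ u v = trans (cong (_⊕ v) (scale-false u)) (⊕-identityˡ v)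

scale-xor : ∀ x y u → scale (x xor y) u ≡ scale x u ⊕ scale y u
scale-xor x y u = ≡-by-lookup λ i → begin
  lookup (scale (x xor y) u) i                        ≡⟨ Vec.lookup-map i _ u ⟩
  (x xor y) ∧ lookup u i                              ≡⟨ ∧-distribʳ-xor (lookup u i) x y ⟩
  (x ∧ lookup u i) xor (y ∧ lookup u i)               ≡⟨ cong₂ _xor_ (sym (Vec.lookup-map i _ u)) (sym (Vec.lookup-map i _ u)) ⟩
  lookup (scale x u) i xor lookup (scale y u) i       ≡⟨ sym (Vec.lookup-zipWith _xor_ i (scale x u) (scale y u)) ⟩
  lookup (scale x u ⊕ scale y u) i                    ∎
  where open ≡-Reasoning

lincomb-zeros : ∀ {k} (b : Vec V k) → lincomb (zeros k) b ≡ zeroV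
lincomb-zeros []      = refl
lincomb-zeros (u ∷ b) = trans (cong₂ _⊕_ (scale-false u) (lincomb-zeros b)) (⊕-self zeroV)

lincomb-⊕ : ∀ {k} (c d : Vec Bool k) (b : Vec V k) → lincomb (c ⊕ₙ d) b ≡ lincomb c b ⊕ lincomb d b
lincomb-⊕ []      []      []      = sym (⊕-self zeroV)
lincomb-⊕ (x ∷ c) (y ∷ d) (u ∷ b) = begin
  scale (x xor y) u ⊕ lincomb (c ⊕ₙ d) b                  ≡⟨ cong₂ _⊕_ (scale-xor x y u) (lincomb-⊕ c d b) ⟩
  (scale x u ⊕ scale y u) ⊕ (lincomb c b ⊕ lincomb d b)   ≡⟨ ⊕-interchange _ _ _ _ ⟩
  (scale x u ⊕ lincomb c b) ⊕ (scale y u ⊕ lincomb d b)   ∎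
  where open ≡-Reasoning

lincomb-++ : ∀ {k m} (c : Vec Bool k) (d : Vec Bool m) (b : Vec V k) (b′ : Vec V m) →
             lincomb (c ++ d) (b ++ b′) ≡ lincomb c b ⊕ lincomb d b′
lincomb-++ []      d []      b′ = sym (⊕-identityˡ _)
lincomb-++ (x ∷ c) d (u ∷ b) b′ =
  trans (cong (scale x u ⊕_) (lincomb-++ c d b b′)) (sym (⊕-assoc _ _ _))

lincomb-insertAt : ∀ {k} (c : Vec Bool k) (b : Vec V (suc k)) p →
                   lincomb (insertAt c p false) b ≡ lincomb c (removeAt b p)
lincomb-insertAt c       (u ∷ b)     zero    = scale-false-⊕ u _
lincomb-insertAt (x ∷ c) (u ∷ v ∷ b) (suc p) = cong (scale x u ⊕_) (lincomb-insertAt c (v ∷ b) p)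

insertAt-false≡zeros : ∀ {k} (c : Vec Bool k) p → insertAt c p false ≡ zeros (suc k) → c ≡ zeros k
insertAt-false≡zeros c p eq =
  trans (sym (Vec.removeAt-insertAt c p false)) (trans (cong (λ d → removeAt d p) eq) (removeAt-zeros p))
  where
  removeAt-zeros : ∀ {k} (p : Fin (suc k)) → removeAt (zeros (suc k)) p ≡ zeros k
  removeAt-zeros          zero    = refl
  removeAt-zeros {suc k} (suc p) = cong (false ∷_) (removeAt-zeros p)

All-removeAt : ∀ {a p} {A : Set a} {P : A → Set p} {n} {xs : Vec A (suc n)} → All P xs → ∀ i → All P (removeAt xs i)
All-removeAt                   (_  ∷ pxs) zero    = pxs
All-removeAt {xs = _ ∷ _ ∷ _} (px ∷ pxs) (suc i) = px ∷ All-removeAt pxs i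

onehot : ∀ {k} → Fin k → Vec Bool k
onehot i = tabulate (λ j → ⌊ i Fin.≟ j ⌋)

lincomb-onehot : ∀ {k} (i : Fin k) (b : Vec V k) → lincomb (onehot i) b ≡ lookup b i
lincomb-onehot zero (u ∷ b) = begin
  scale true u ⊕ lincomb (tabulate (λ j → ⌊ zero Fin.≟ suc j ⌋)) b
    ≡⟨ cong₂ _⊕_ (scale-true u) (cong (λ c → lincomb c b) tabulate-false) ⟩
  u ⊕ lincomb (zeros _) b   ≡⟨ cong (u ⊕_) (lincomb-zeros b) ⟩
  u ⊕ zeroV                 ≡⟨ ⊕-identityʳ u ⟩
  u                         ∎
  where
  open ≡-Reasoning
  tabulate-false : tabulate (λ _ → false) ≡ zeros _
  tabulate-false = ≡-by-lookup λ j → trans (Vec.lookup∘tabulate _ j) (sym (Vec.lookup-replicate j false))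
lincomb-onehot (suc i) (u ∷ b) = begin
  scale false u ⊕ lincomb (tabulate (λ j → ⌊ suc i Fin.≟ suc j ⌋)) b
    ≡⟨ cong₂ _⊕_ (scale-false u) (cong (λ c → lincomb c b) (Vec.tabulate-cong (λ j → ≟-suc i j))) ⟩
  zeroV ⊕ lincomb (onehot i) b  ≡⟨ ⊕-identityˡ _ ⟩
  lincomb (onehot i) b          ≡⟨ lincomb-onehot i b ⟩
  lookup b i                    ∎
  where
  open ≡-Reasoning
  ≟-suc : ∀ {k} (i j : Fin k) → ⌊ suc i Fin.≟ suc j ⌋ ≡ ⌊ i Fin.≟ j ⌋
  ≟-suc i j with i Fin.≟ j
  ... | yes _ = refl
  ... | no  _ = refl

·-⊕ : ∀ u v A → (u ⊕ v) · A ≡ (u · A) ⊕ (v · A)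
·-⊕ u v = lincomb-⊕ u v

zeroV-· : ∀ A → zeroV · A ≡ zeroV
zeroV-· = lincomb-zeros

scale-· : ∀ x u A → scale x u · A ≡ scale x (u · A)
scale-· true  u A = trans (cong (_· A) (scale-true u)) (sym (scale-true _))
scale-· false u A = trans (cong (_· A) (scale-false u)) (trans (zeroV-· A) (sym (scale-false _)))

lincomb-· : ∀ {k} (c : Vec Bool k) (b : Vec V k) A → lincomb c b · A ≡ lincomb c (map (_· A) b)
lincomb-· []      []      A = zeroV-· A
lincomb-· (x ∷ c) (u ∷ b) A =
  trans (·-⊕ (scale x u) (lincomb c b) A) (cong₂ _⊕_ (scale-· x u A) (lincomb-· c b A))

·-* : ∀ u A B → u · (A * B) ≡ (u · A) · B
·-* u A B = sym (lincomb-· u A B)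

*-assoc : ∀ A B C → (A * B) * C ≡ A * (B * C)
*-assoc A B C = trans (sym (Vec.map-∘ (_· C) (_· B) A)) (Vec.map-cong (λ u → sym (·-* u B C)) A)

lookup-I : ∀ i → lookup I i ≡ onehot i
lookup-I = Vec.lookup∘tabulate onehot

*-identityˡ : ∀ A → I * A ≡ A
*-identityˡ A = ≡-by-lookup λ i → begin
  lookup (I * A) i      ≡⟨ Vec.lookup-map i (_· A) I ⟩
  lookup I i · A        ≡⟨ cong (_· A) (lookup-I i) ⟩
  lincomb (onehot i) A  ≡⟨ lincomb-onehot i A ⟩
  lookup A i            ∎
  where open ≡-Reasoning

module ⊕-Solver where

  infixl 6 _⊞_

  data Expr (n : ℕ) : Set where
    var : Fin n → Expr n
    _⊞_ : Expr n → Expr n → Expr n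
    𝟎   : Expr n

  ⟦_⟧ : ∀ {n} → Expr n → Vec V n → V
  ⟦ var i  ⟧ ρ = lookup ρ i
  ⟦ e ⊞ e′ ⟧ ρ = ⟦ e ⟧ ρ ⊕ ⟦ e′ ⟧ ρ
  ⟦ 𝟎      ⟧ ρ = zeroV

  normal : ∀ {n} → Expr n → Vec Bool n
  normal (var i)  = onehot i
  normal (e ⊞ e′) = normal e ⊕ₙ normal e′
  normal 𝟎        = zeros _

  ⟦⟧≡lincomb-normal : ∀ {n} (e : Expr n) ρ → ⟦ e ⟧ ρ ≡ lincomb (normal e) ρ
  ⟦⟧≡lincomb-normal (var i)  ρ = sym (lincomb-onehot i ρ)
  ⟦⟧≡lincomb-normal (e ⊞ e′) ρ = trans (cong₂ _⊕_ (⟦⟧≡lincomb-normal e ρ) (⟦⟧≡lincomb-normal e′ ρ))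
                                        (sym (lincomb-⊕ (normal e) (normal e′) ρ))
  ⟦⟧≡lincomb-normal 𝟎        ρ = sym (lincomb-zeros ρ)

  solve : ∀ {n} (e e′ : Expr n) ρ → normal e ≡ normal e′ → ⟦ e ⟧ ρ ≡ ⟦ e′ ⟧ ρ
  solve e e′ ρ eq = trans (⟦⟧≡lincomb-normal e ρ)
                          (trans (cong (λ c → lincomb c ρ) eq) (sym (⟦⟧≡lincomb-normal e′ ρ)))

open ⊕-Solver

-- Deciding properties of F₂ⁿ by exhaustion

∀? : ∀ {n} {P : Vec Bool n → Set} → (∀ u → Dec (P u)) → Dec (∀ u → P u)
∀? {zero}          P? = map′ (λ { p [] → p }) (λ h → h []) (P? [])
∀? {suc n} {P = P} P? =
  map′ (λ { (t , f) (true ∷ u) → t u ; (t , f) (false ∷ u) → f u })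
       (λ h → h ∘ (true ∷_) , h ∘ (false ∷_))
       (∀? {P = P ∘ (true ∷_)} (P? ∘ (true ∷_)) ×-dec ∀? {P = P ∘ (false ∷_)} (P? ∘ (false ∷_)))

∃? : ∀ {n} {P : Vec Bool n → Set} → (∀ u → Dec (P u)) → Dec (∃ P)
∃? {zero}          P? = map′ ([] ,_) (λ { ([] , p) → p }) (P? [])
∃? {suc n} {P = P} P? =
  map′ (λ { (inj₁ (u , p)) → true ∷ u , p ; (inj₂ (u , p)) → false ∷ u , p })
       (λ { (true ∷ u , p) → inj₁ (u , p) ; (false ∷ u , p) → inj₂ (u , p) })
       (∃? {P = P ∘ (true ∷_)} (P? ∘ (true ∷_)) ⊎-dec ∃? {P = P ∘ (false ∷_)} (P? ∘ (false ∷_)))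

-- The implicit argument is discharged by the type checker evaluating ∀? on all 2ⁿ vectors.
by-exhaustion : ∀ {n} {P : Vec Bool n → Set} (P? : ∀ u → Dec (P u)) → {True (∀? P?)} → ∀ u → P u
by-exhaustion P? {t} = toWitness t

infix 4 _≟ᵥ_

_≟ᵥ_ : ∀ {n} (u v : Vec Bool n) → Dec (u ≡ v)
_≟ᵥ_ = Vec.≡-dec _≟ᵇ_

·-identityʳ : ∀ u → u · I ≡ u
·-identityʳ = by-exhaustion (λ u → u · I ≟ᵥ u)

*-identityʳ : ∀ A → A * I ≡ A
*-identityʳ A = trans (Vec.map-cong ·-identityʳ A) (Vec.map-id A)

-- Span, independence and dimension

InSpan? : ∀ {k} (b : Vec V k) u → Dec (InSpan b u)
InSpan? b u = ∃? (λ c → lincomb c b ≟ᵥ u)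

LinIndep? : ∀ {k} (b : Vec V k) → Dec (LinIndep b)
LinIndep? b = ∀? (λ c → (lincomb c b ≟ᵥ zeroV) →-dec (c ≟ᵥ zeros _))

span-zeroV : ∀ {k} (b : Vec V k) → InSpan b zeroV
span-zeroV b = zeros _ , lincomb-zeros b

span-⊕ : ∀ {k} {b : Vec V k} {u v} → InSpan b u → InSpan b v → InSpan b (u ⊕ v)
span-⊕ {b = b} (c , refl) (d , refl) = c ⊕ₙ d , lincomb-⊕ c d b

span-scale : ∀ {k} {b : Vec V k} x {u} → InSpan b u → InSpan b (scale x u)
span-scale {b = b} true  p = subst (InSpan b) (sym (scale-true _)) p
span-scale {b = b} false p = subst (InSpan b) (sym (scale-false _)) (span-zeroV b)

span-lincomb : ∀ {k m} {c : Vec V k} {b : Vec V m} → All (InSpan c) b → ∀ x → InSpan c (lincomb x b)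
span-lincomb {c = c} []       []      = span-zeroV c
span-lincomb         (p ∷ ps) (x ∷ xs) = span-⊕ (span-scale x p) (span-lincomb ps xs)

span-∷ : ∀ {k} {b : Vec V k} x {u} → InSpan b u → InSpan (x ∷ b) u
span-∷ x (c , refl) = false ∷ c , scale-false-⊕ x _

span-lookup : ∀ {k} (b : Vec V k) i → InSpan b (lookup b i)
span-lookup b i = onehot i , lincomb-onehot i b

span-⊆ : ∀ {k m} {c : Vec V k} {b : Vec V m} → All (InSpan c) b → ∀ {x} → InSpan b x → InSpan c x
span-⊆ b⊆c (d , refl) = span-lincomb b⊆c d

lincomb-injective : ∀ {k} {b : Vec V k} → LinIndep b → ∀ c d → lincomb c b ≡ lincomb d b → c ≡ d
lincomb-injective {b = b} indep c d eq = ⊕≡zeros⇒≡ c d (indep (c ⊕ₙ d)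
  (trans (lincomb-⊕ c d b) (trans (cong (_⊕ lincomb d b) eq) (⊕-self _))))

linIndep-∷ : ∀ {k} {b : Vec V k} {u} → LinIndep b → ¬ InSpan b u → LinIndep (u ∷ b)
linIndep-∷ {b = b} {u} indep u∉ (true ∷ c) eq =
  ⊥-elim (u∉ (c , sym (⊕≡zeros⇒≡ u (lincomb c b) (trans (sym (scale-true-⊕ u _)) eq))))
linIndep-∷ {b = b} {u} indep u∉ (false ∷ c) eq =
  cong (false ∷_) (indep c (trans (sym (scale-false-⊕ u _)) eq))

¬linIndep⇒relation : ∀ {k} {b : Vec V k} → ¬ LinIndep b → Σ (Vec Bool k) λ c → lincomb c b ≡ zeroV × c ≢ zeros k
¬linIndep⇒relation {b = b} dep = decidable-stable (∃? λ c → (lincomb c b ≟ᵥ zeroV) ×-dec ¬? (c ≟ᵥ zeros _))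
  λ none → dep λ c eq → decidable-stable (c ≟ᵥ zeros _) λ c≢0 → none (c , eq , c≢0)

linIndep-++ : ∀ {k m} {b : Vec V k} {d : Vec V m} → LinIndep b → LinIndep d →
              (∀ x → InSpan b x → InSpan d x → x ≡ zeroV) → LinIndep (b ++ d)
linIndep-++ {k} {m} {b} {d} b-indep d-indep disjoint c relation with splitAt k c
... | c₁ , c₂ , refl = trans (cong₂ _++_ (b-indep c₁ x≡0) (d-indep c₂ (trans (sym same) x≡0))) (zeros-++ k)
  where
  same : lincomb c₁ b ≡ lincomb c₂ d
  same = ⊕≡zeros⇒≡ _ _ (trans (sym (lincomb-++ c₁ c₂ b d)) relation)
  x≡0 : lincomb c₁ b ≡ zeroV
  x≡0 = disjoint _ (c₁ , refl) (c₂ , sym same)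
  zeros-++ : ∀ k {m} → zeros k ++ zeros m ≡ zeros (k + m)
  zeros-++ zero    = refl
  zeros-++ (suc k) = cong (false ∷_) (zeros-++ k)

linIndep-pair : ∀ {x y} → x ≢ zeroV → y ≢ zeroV → x ≢ y → LinIndep (x ∷ y ∷ [])
linIndep-pair {x} {y} x≢0 y≢0 x≢y (c₁ ∷ c₂ ∷ []) eq = cases c₁ c₂ (trans (sym pair) eq)
  where
  pair : lincomb (c₁ ∷ c₂ ∷ []) (x ∷ y ∷ []) ≡ scale c₁ x ⊕ scale c₂ y
  pair = cong (scale c₁ x ⊕_) (⊕-identityʳ _)
  cases : ∀ c₁ c₂ → scale c₁ x ⊕ scale c₂ y ≡ zeroV → c₁ ∷ c₂ ∷ [] ≡ zeros 2
  cases true  true  eq = ⊥-elim (x≢y (⊕≡zeros⇒≡ x y (trans (sym (cong₂ _⊕_ (scale-true x) (scale-true y))) eq)))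
  cases true  false eq = ⊥-elim (x≢0 (trans (sym (⊕-identityʳ x)) (trans (sym (cong₂ _⊕_ (scale-true x) (scale-false y))) eq)))
  cases false true  eq = ⊥-elim (y≢0 (trans (sym (⊕-identityˡ y)) (trans (sym (cong₂ _⊕_ (scale-false x) (scale-true y))) eq)))
  cases false false eq = refl

bit : Bool → Fin 2
bit true  = zero
bit false = suc zero

bool : Fin 2 → Bool
bool zero       = true
bool (suc zero) = false

toFin : ∀ {n} → Vec Bool n → Fin (2 ^ n)
toFin []      = zero
toFin (x ∷ u) = combine (bit x) (toFin u)

fromFin : ∀ {n} → Fin (2 ^ n) → Vec Bool n
fromFin {zero}  i = []
fromFin {suc n} i = bool (proj₁ (remQuot {2} (2 ^ n) i)) ∷ fromFin {n} (proj₂ (remQuot {2} (2 ^ n) i))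

toFin-fromFin : ∀ {n} (i : Fin (2 ^ n)) → toFin (fromFin {n} i) ≡ i
toFin-fromFin {zero}  zero = refl
toFin-fromFin {suc n} i    =
  trans (cong₂ combine (bit-bool (proj₁ (remQuot {2} (2 ^ n) i))) (toFin-fromFin {n} (proj₂ (remQuot {2} (2 ^ n) i))))
        (Fin.combine-remQuot {2} (2 ^ n) i)
  where
  bit-bool : ∀ b → bit (bool b) ≡ b
  bit-bool zero       = refl
  bit-bool (suc zero) = refl

toFin-injective : ∀ {n} {u v : Vec Bool n} → toFin u ≡ toFin v → u ≡ v
toFin-injective {u = []}    {[]}    _  = refl
toFin-injective {u = x ∷ u} {y ∷ v} eq =
  cong₂ _∷_ (bit-injective (Fin.combine-injectiveˡ (bit x) (toFin u) (bit y) (toFin v) eq))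
            (toFin-injective (Fin.combine-injectiveʳ (bit x) (toFin u) (bit y) (toFin v) eq))
  where
  bit-injective : ∀ {x y} → bit x ≡ bit y → x ≡ y
  bit-injective {true}  {true}  _ = refl
  bit-injective {false} {false} _ = refl

fromFin-injective : ∀ {n} {i j : Fin (2 ^ n)} → fromFin {n} i ≡ fromFin j → i ≡ j
fromFin-injective {n} {i} {j} eq = trans (sym (toFin-fromFin {n} i)) (trans (cong toFin eq) (toFin-fromFin {n} j))

indexed-injective⇒≤ : ∀ {k m n} (g : Fin k → Vec Bool m → Vec Bool n) →
                      (∀ i s j t → g i s ≡ g j t → i ≡ j × s ≡ t) → k *ℕ 2 ^ m ≤ 2 ^ n
indexed-injective⇒≤ {k} {m} {n} g g-inj = Fin.injective⇒≤ h-inj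
  where
  h : Fin (k *ℕ 2 ^ m) → Fin (2 ^ n)
  h x = toFin (g (proj₁ (remQuot {k} (2 ^ m) x)) (fromFin {m} (proj₂ (remQuot {k} (2 ^ m) x))))
  h-inj : ∀ {x y} → h x ≡ h y → x ≡ y
  h-inj {x} {y} eq with g-inj _ _ _ _ (toFin-injective {n} eq)
  ... | i≡j , s≡t = trans (sym (Fin.combine-remQuot {k} (2 ^ m) x))
                      (trans (cong₂ combine i≡j (fromFin-injective {m} s≡t)) (Fin.combine-remQuot {k} (2 ^ m) y))

injective⇒≤ : ∀ {m n} (f : Vec Bool m → Vec Bool n) → (∀ u v → f u ≡ f v → u ≡ v) → m ≤ n
injective⇒≤ {m} {n} f f-inj = ℕ.≮⇒≥ λ n<m → ℕ.<⇒≱ (ℕ.^-monoʳ-< 2 (s≤s (s≤s z≤n)) n<m) 2^m≤2^n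
  where
  2^m≤2^n : 2 ^ m ≤ 2 ^ n
  2^m≤2^n = subst (_≤ 2 ^ n) (ℕ.*-identityˡ (2 ^ m))
              (indexed-injective⇒≤ {k = 1} (λ _ → f) λ { zero s zero t e → refl , f-inj s t e })

steinitz : ∀ {m n} {b : Vec V m} {c : Vec V n} → LinIndep b → All (InSpan c) b → m ≤ n
steinitz {b = b} {c} indep b⊆c = injective⇒≤ coords coords-injective
  where
  coords : Vec Bool _ → Vec Bool _
  coords x = proj₁ (span-lincomb b⊆c x)
  coords-injective : ∀ x y → coords x ≡ coords y → x ≡ y
  coords-injective x y eq = lincomb-injective indep x y
    (trans (sym (proj₂ (span-lincomb b⊆c x))) (trans (cong (λ d → lincomb d c) eq) (proj₂ (span-lincomb b⊆c y))))

I-spans : ∀ u → InSpan I u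
I-spans u = u , ·-identityʳ u

linIndep-I : LinIndep I
linIndep-I c eq = trans (sym (·-identityʳ c)) eq

linIndep⇒≤7 : ∀ {k} {b : Vec V k} → LinIndep b → k ≤ 7
linIndep⇒≤7 {b = b} indep = steinitz indep (lookup⁻ λ i → I-spans (lookup b i))

spanning⇒≥7 : ∀ {k} {b : Vec V k} → (∀ u → InSpan b u) → 7 ≤ k
spanning⇒≥7 spans = steinitz linIndep-I (lookup⁻ λ i → spans _)

basis-spans : ∀ {P : Mat} → LinIndep P → ∀ u → InSpan P u
basis-spans {P} indep u with InSpan? P u
... | yes u∈P = u∈P
... | no  u∉P = ⊥-elim (8≰7 (linIndep⇒≤7 (linIndep-∷ indep u∉P)))
  where
  8≰7 : ¬ (8 ≤ 7)
  8≰7 (s≤s (s≤s (s≤s (s≤s (s≤s (s≤s (s≤s ())))))))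

linIndep⇒invertible : ∀ {P} → LinIndep P → Invertible P
linIndep⇒invertible {P} indep = Q , PQ≡I , QP≡I
  where
  coords : Fin 7 → V
  coords j = proj₁ (basis-spans indep (lookup I j))
  Q : Mat
  Q = tabulate coords
  QP≡I : Q * P ≡ I
  QP≡I = ≡-by-lookup λ j → begin
    lookup (Q * P) j   ≡⟨ Vec.lookup-map j (_· P) Q ⟩
    lookup Q j · P     ≡⟨ cong (_· P) (Vec.lookup∘tabulate coords j) ⟩
    coords j · P       ≡⟨ proj₂ (basis-spans indep (lookup I j)) ⟩
    lookup I j         ∎
    where open ≡-Reasoning
  PQ≡I : P * Q ≡ I
  PQ≡I = ≡-by-lookup λ i → trans (Vec.lookup-map i (_· Q) P) (lincomb-injective indep _ _ (begin
    (lookup P i · Q) · P  ≡⟨ sym (·-* (lookup P i) Q P) ⟩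
    lookup P i · (Q * P)  ≡⟨ cong (lookup P i ·_) QP≡I ⟩
    lookup P i · I        ≡⟨ ·-identityʳ _ ⟩
    lookup P i            ≡⟨ sym (lincomb-onehot i P) ⟩
    onehot i · P          ≡⟨ cong (_· P) (sym (lookup-I i)) ⟩
    lookup I i · P        ∎))
    where open ≡-Reasoning

record MaximalFamily (P : V → Set) : Set where
  field
    size        : ℕ
    family      : Vec V size
    independent : LinIndep family
    members     : All P family
    spans       : ∀ u → P u → InSpan family u

module _ {P : V → Set} (P? : ∀ u → Dec (P u)) where

  extend-family : ∀ m {k} (b : Vec V k) → m + k ≡ 7 → LinIndep b → All P b → MaximalFamily P
  extend-family zero    b refl indep Pb = record
    { family = b ; independent = indep ; members = Pb ; spans = λ u _ → basis-spans indep u }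
  extend-family (suc m) b m+k≡7 indep Pb with ∃? (λ u → P? u ×-dec ¬? (InSpan? b u))
  ... | yes (u , Pu , u∉b) =
    extend-family m (u ∷ b) (trans (ℕ.+-suc m _) m+k≡7) (linIndep-∷ indep u∉b) (Pu ∷ Pb)
  ... | no  none           = record
    { family = b ; independent = indep ; members = Pb
    ; spans = λ u Pu → decidable-stable (InSpan? b u) λ u∉b → none (u , Pu , u∉b) }

  maximalFamily : MaximalFamily P
  maximalFamily = extend-family 7 [] refl (λ { [] _ → refl }) []

-- Subgroups of order 3 and conjugation

*-cancelˡ : ∀ {A X Y} → Invertible A → A * X ≡ A * Y → X ≡ Y
*-cancelˡ {A} {X} {Y} (A⁻¹ , _ , A⁻¹A≡I) eq = begin
  X               ≡⟨ sym (*-identityˡ X) ⟩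
  I * X           ≡⟨ cong (_* X) (sym A⁻¹A≡I) ⟩
  (A⁻¹ * A) * X   ≡⟨ *-assoc A⁻¹ A X ⟩
  A⁻¹ * (A * X)   ≡⟨ cong (A⁻¹ *_) eq ⟩
  A⁻¹ * (A * Y)   ≡⟨ sym (*-assoc A⁻¹ A Y) ⟩
  (A⁻¹ * A) * Y   ≡⟨ cong (_* Y) A⁻¹A≡I ⟩
  I * Y           ≡⟨ *-identityˡ Y ⟩
  Y               ∎
  where open ≡-Reasoning

*-cancelʳ : ∀ {A X Y} → Invertible A → X * A ≡ Y * A → X ≡ Y
*-cancelʳ {A} {X} {Y} (A⁻¹ , AA⁻¹≡I , _) eq = begin
  X               ≡⟨ sym (*-identityʳ X) ⟩
  X * I           ≡⟨ cong (X *_) (sym AA⁻¹≡I) ⟩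
  X * (A * A⁻¹)   ≡⟨ sym (*-assoc X A A⁻¹) ⟩
  (X * A) * A⁻¹   ≡⟨ cong (_* A⁻¹) eq ⟩
  (Y * A) * A⁻¹   ≡⟨ *-assoc Y A A⁻¹ ⟩
  Y * (A * A⁻¹)   ≡⟨ cong (Y *_) AA⁻¹≡I ⟩
  Y * I           ≡⟨ *-identityʳ Y ⟩
  Y               ∎
  where open ≡-Reasoning

record CyclicOfOrder3 (G : Mat → Set) : Set where
  field
    generator   : Mat
    generator≢I : generator ≢ I
    generator³  : generator ^ᴹ 3 ≡ I
    members     : ∀ X → G X ⇔ (∃ λ k → X ≡ generator ^ᴹ k)

module _ {G : Mat → Set} (subgroup : IsSubgroupGL G) where

  private
    invertible : ∀ A → G A → Invertible A
    invertible = proj₁ subgroup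
    G-I : G I
    G-I = proj₁ (proj₂ subgroup)
    G-* : ∀ A B → G A → G B → G (A * B)
    G-* = proj₁ (proj₂ (proj₂ subgroup))

  G-^ : ∀ {A} → G A → ∀ k → G (A ^ᴹ k)
  G-^ GA zero    = G-I
  G-^ GA (suc k) = G-* _ _ GA (G-^ GA k)

  three-elements⇒cyclic : ∀ {A B} → G A → G B → A ≢ I → B ≢ I → A ≢ B →
                          (∀ C → G C → C ≡ I ⊎ C ≡ A ⊎ C ≡ B) → CyclicOfOrder3 G
  three-elements⇒cyclic {A} {B} GA GB A≢I B≢I A≢B only = record
    { generator = A ; generator≢I = A≢I ; generator³ = A³≡I ; members = λ X → mk⇔ (powers X) (λ { (k , refl) → G-^ GA k }) }
    where
    A*I≡A : A * I ≡ A
    A*I≡A = *-identityʳ A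
    AB≡I : A * B ≡ I
    AB≡I with only (A * B) (G-* _ _ GA GB)
    ... | inj₁ AB≡I        = AB≡I
    ... | inj₂ (inj₁ AB≡A) = ⊥-elim (B≢I (*-cancelˡ (invertible A GA) (trans AB≡A (sym A*I≡A))))
    ... | inj₂ (inj₂ AB≡B) = ⊥-elim (A≢I (*-cancelʳ (invertible B GB) (trans AB≡B (sym (*-identityˡ B)))))
    AA≡B : A * A ≡ B
    AA≡B with only (A * A) (G-* _ _ GA GA)
    ... | inj₁ AA≡I        = ⊥-elim (A≢B (*-cancelˡ (invertible A GA) (trans AA≡I (sym AB≡I))))
    ... | inj₂ (inj₁ AA≡A) = ⊥-elim (A≢I (*-cancelˡ (invertible A GA) (trans AA≡A (sym A*I≡A))))
    ... | inj₂ (inj₂ AA≡B) = AA≡B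
    A²≡B : A ^ᴹ 2 ≡ B
    A²≡B = trans (cong (A *_) A*I≡A) AA≡B
    A³≡I : A ^ᴹ 3 ≡ I
    A³≡I = trans (cong (A *_) A²≡B) AB≡I
    powers : ∀ X → G X → ∃ λ k → X ≡ A ^ᴹ k
    powers X GX with only X GX
    ... | inj₁ X≡I        = 0 , X≡I
    ... | inj₂ (inj₁ X≡A) = 1 , trans X≡A (sym A*I≡A)
    ... | inj₂ (inj₂ X≡B) = 2 , trans X≡B (sym A²≡B)

  order3⇒cyclic : HasOrder3 G → CyclicOfOrder3 G
  order3⇒cyclic (X , Y , Z , X≢Y , X≢Z , Y≢Z , GX , GY , GZ , only) with only I G-I
  ... | inj₁ refl        = three-elements⇒cyclic GY GZ (X≢Y ∘ sym) (X≢Z ∘ sym) Y≢Z only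
  ... | inj₂ (inj₁ refl) = three-elements⇒cyclic GX GZ X≢Y (Y≢Z ∘ sym) X≢Z (λ C → swap₁₂ ∘ only C)
    where
    swap₁₂ : ∀ {C} → C ≡ X ⊎ C ≡ I ⊎ C ≡ Z → C ≡ I ⊎ C ≡ X ⊎ C ≡ Z
    swap₁₂ (inj₁ e)        = inj₂ (inj₁ e)
    swap₁₂ (inj₂ (inj₁ e)) = inj₁ e
    swap₁₂ (inj₂ (inj₂ e)) = inj₂ (inj₂ e)
  ... | inj₂ (inj₂ refl) = three-elements⇒cyclic GX GY X≢Z Y≢Z X≢Y (λ C → rotate ∘ only C)
    where
    rotate : ∀ {C} → C ≡ X ⊎ C ≡ Y ⊎ C ≡ I → C ≡ I ⊎ C ≡ X ⊎ C ≡ Y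
    rotate (inj₁ e)        = inj₂ (inj₁ e)
    rotate (inj₂ (inj₁ e)) = inj₂ (inj₂ e)
    rotate (inj₂ (inj₂ e)) = inj₁ e

module _ {M P Q : Mat} (PQ≡I : P * Q ≡ I) (QP≡I : Q * P ≡ I) where

  conjugate-* : ∀ N → (Q * (M * P)) * (Q * (N * P)) ≡ Q * ((M * N) * P)
  conjugate-* N = begin
    (Q * (M * P)) * (Q * (N * P))  ≡⟨ *-assoc Q _ _ ⟩
    Q * ((M * P) * (Q * (N * P)))  ≡⟨ cong (Q *_) (*-assoc M P _) ⟩
    Q * (M * (P * (Q * (N * P))))  ≡⟨ cong (λ t → Q * (M * t)) (sym (*-assoc P Q _)) ⟩
    Q * (M * ((P * Q) * (N * P)))  ≡⟨ cong (λ t → Q * (M * (t * (N * P)))) PQ≡I ⟩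
    Q * (M * (I * (N * P)))        ≡⟨ cong (λ t → Q * (M * t)) (*-identityˡ _) ⟩
    Q * (M * (N * P))              ≡⟨ cong (Q *_) (sym (*-assoc M N P)) ⟩
    Q * ((M * N) * P)              ∎
    where open ≡-Reasoning

  conjugate-^ : ∀ {A} → Q * (M * P) ≡ A → ∀ k → Q * ((M ^ᴹ k) * P) ≡ A ^ᴹ k
  conjugate-^ QMP≡A zero    = trans (cong (Q *_) (*-identityˡ P)) QP≡I
  conjugate-^ QMP≡A (suc k) = trans (sym (conjugate-* (M ^ᴹ k))) (cong₂ _*_ QMP≡A (conjugate-^ QMP≡A k))

  conjugateToCyclic : ∀ {G} (cyclic : CyclicOfOrder3 G) → Q * (M * P) ≡ CyclicOfOrder3.generator cyclic →
                      ConjugateToCyclic G M P Q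
  conjugateToCyclic cyclic QMP≡A X = mk⇔
    (λ GX → let k , X≡Aᵏ = to (members X) GX in k , trans X≡Aᵏ (sym (conjugate-^ QMP≡A k)))
    (λ { (k , X≡QMᵏP) → from (members X) (k , trans X≡QMᵏP (conjugate-^ QMP≡A k)) })
    where
    open CyclicOfOrder3 cyclic
    open Equivalence

-- Normal form of a matrix of order 3

-- A representative of the remaining conjugacy class of elements of order 3; its fixed space has dimension 5.
M₃ : Mat
M₃ = (false ∷ true  ∷ false ∷ false ∷ false ∷ false ∷ false ∷ []) ∷
     (true  ∷ true  ∷ false ∷ false ∷ false ∷ false ∷ false ∷ []) ∷
     (false ∷ false ∷ true  ∷ false ∷ false ∷ false ∷ false ∷ []) ∷
     (false ∷ false ∷ false ∷ true  ∷ false ∷ false ∷ false ∷ []) ∷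
     (false ∷ false ∷ false ∷ false ∷ true  ∷ false ∷ false ∷ []) ∷
     (false ∷ false ∷ false ∷ false ∷ false ∷ true  ∷ false ∷ []) ∷
     (false ∷ false ∷ false ∷ false ∷ false ∷ false ∷ true  ∷ []) ∷ []

-- The rows of P form a basis in which A acts as M.
Similar : Mat → Mat → Set
Similar A M = Σ Mat λ P → LinIndep P × (P * A ≡ M * P)

room-for-pair : ∀ m n → m + n ≡ 7 → 2 + n ≤ 7 → 2 ≤ m
room-for-pair zero          n refl (s≤s (s≤s (s≤s (s≤s (s≤s (s≤s (s≤s ())))))))
room-for-pair (suc zero)    n refl (s≤s (s≤s (s≤s (s≤s (s≤s (s≤s (s≤s ())))))))
room-for-pair (suc (suc m)) n _    _ = s≤s (s≤s z≤n)

module Order3 (A : Mat) (A³≡I : A ^ᴹ 3 ≡ I) where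

  Fixed : V → Set
  Fixed v = v · A ≡ v

  norm : V → V
  norm v = (v ⊕ (v · A)) ⊕ ((v · A) · A)

  NormZero : V → Set
  NormZero v = norm v ≡ zeroV

  ·A³ : ∀ v → ((v · A) · A) · A ≡ v
  ·A³ v = begin
    ((v · A) · A) · A        ≡⟨ sym (·-identityʳ _) ⟩
    (((v · A) · A) · A) · I  ≡⟨ sym (·-* ((v · A) · A) A I) ⟩
    ((v · A) · A) · (A ^ᴹ 1) ≡⟨ sym (·-* (v · A) A (A ^ᴹ 1)) ⟩
    (v · A) · (A ^ᴹ 2)       ≡⟨ sym (·-* v A (A ^ᴹ 2)) ⟩
    v · (A ^ᴹ 3)             ≡⟨ cong (v ·_) A³≡I ⟩
    v · I                    ≡⟨ ·-identityʳ v ⟩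
    v                        ∎
    where open ≡-Reasoning

  orbit : V → Vec V 3
  orbit v = v ∷ v · A ∷ (v · A) · A ∷ []

  norm-fixed : ∀ v → Fixed (norm v)
  norm-fixed v = begin
    norm v · A                                 ≡⟨ ·-⊕ (v ⊕ (v · A)) ((v · A) · A) A ⟩
    ((v ⊕ (v · A)) · A) ⊕ (((v · A) · A) · A)  ≡⟨ cong₂ _⊕_ (·-⊕ v (v · A) A) (·A³ v) ⟩
    ((v · A) ⊕ ((v · A) · A)) ⊕ v              ≡⟨ solve ((var (# 1) ⊞ var (# 2)) ⊞ var (# 0))
                                                        ((var (# 0) ⊞ var (# 1)) ⊞ var (# 2)) (orbit v) refl ⟩
    norm v                                     ∎
    where open ≡-Reasoning

  normZero-·A² : ∀ {v} → NormZero v → (v · A) · A ≡ v ⊕ (v · A)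
  normZero-·A² v0 = sym (⊕≡zeros⇒≡ _ _ v0)

  trace : V → V
  trace v = (v · A) ⊕ ((v · A) · A)

  trace-·A : ∀ v → trace v · A ≡ ((v · A) · A) ⊕ v
  trace-·A v = trans (·-⊕ (v · A) ((v · A) · A) A) (cong (((v · A) · A) ⊕_) (·A³ v))

  normZero-trace : ∀ v → NormZero (trace v)
  normZero-trace v = begin
    (trace v ⊕ (trace v · A)) ⊕ ((trace v · A) · A)
      ≡⟨ cong₂ (λ s t → (trace v ⊕ s) ⊕ t) (trace-·A v)
               (trans (cong (_· A) (trace-·A v)) (trans (·-⊕ ((v · A) · A) v A) (cong (_⊕ (v · A)) (·A³ v)))) ⟩
    (trace v ⊕ (((v · A) · A) ⊕ v)) ⊕ (v ⊕ (v · A))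
      ≡⟨ solve ((((var (# 1) ⊞ var (# 2))) ⊞ (var (# 2) ⊞ var (# 0))) ⊞ (var (# 0) ⊞ var (# 1))) 𝟎 (orbit v) refl ⟩
    zeroV ∎
    where open ≡-Reasoning

  norm⊕trace : ∀ v → norm v ⊕ trace v ≡ v
  norm⊕trace v = solve (((var (# 0) ⊞ var (# 1)) ⊞ var (# 2)) ⊞ (var (# 1) ⊞ var (# 2))) (var (# 0)) (orbit v) refl

  Fixed? : ∀ v → Dec (Fixed v)
  Fixed? v = v · A ≟ᵥ v

  NormZero? : ∀ v → Dec (NormZero v)
  NormZero? v = norm v ≟ᵥ zeroV

  SpanStable : ∀ {k} → Vec V k → Set
  SpanStable b = All (λ x → InSpan b (x · A)) b

  span-·A : ∀ {k} {b : Vec V k} → SpanStable b → ∀ {u} → InSpan b u → InSpan b (u · A)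
  span-·A {b = b} inv (c , refl) = subst (InSpan b) (sym (lincomb-· c b A)) (span-lincomb (map⁺ inv) c)

  fixed⇒spanStable : ∀ {k} {b : Vec V k} → All Fixed b → SpanStable b
  fixed⇒spanStable {b = b} fixed = lookup⁻ λ i → subst (InSpan b) (sym (lookup⁺ fixed i)) (span-lookup b i)

  span-fixed : ∀ {k} {b : Vec V k} → All Fixed b → ∀ {u} → InSpan b u → Fixed u
  span-fixed {b = b} fixed (c , refl) = trans (lincomb-· c b A) (cong (lincomb c) (map-fixed fixed))
    where
    map-fixed : ∀ {k} {b : Vec V k} → All Fixed b → map (_· A) b ≡ b
    map-fixed []       = refl
    map-fixed (f ∷ fs) = cong₂ _∷_ f (map-fixed fs)

  pairBasis : ∀ {p} → Vec V p → Vec V (p *ℕ 2)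
  pairBasis []       = []
  pairBasis (w ∷ ws) = w ∷ w · A ∷ pairBasis ws

  -- v·A ∉ ⟨b⟩ since v = v·A³, and v ∉ ⟨v·A, b⟩ since (v ⊕ v·A)·A = v when v has norm zero.
  pair-linIndep : ∀ {k} {b : Vec V k} {v} → LinIndep b → SpanStable b → NormZero v → ¬ InSpan b v →
                  LinIndep (v ∷ v · A ∷ b)
  pair-linIndep {b = b} {v} indep inv v0 v∉b = linIndep-∷ (linIndep-∷ indep vA∉b) v∉
    where
    vA∉b : ¬ InSpan b (v · A)
    vA∉b vA∈b = v∉b (subst (InSpan b) (·A³ v) (span-·A inv (span-·A inv vA∈b)))
    v∉ : ¬ InSpan (v · A ∷ b) v
    v∉ (false ∷ c , eq) = v∉b (c , trans (sym (scale-false-⊕ (v · A) _)) eq)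
    v∉ (true  ∷ c , eq) = v∉b (subst (InSpan b) s·A≡v (span-·A inv (c , refl)))
      where
      s : V
      s = lincomb c b
      s·A≡v : s · A ≡ v
      s·A≡v = begin
        s · A                    ≡⟨ cong (_· A) (⊕-moveˡ (trans (sym (scale-true-⊕ (v · A) s)) eq)) ⟩
        ((v · A) ⊕ v) · A        ≡⟨ ·-⊕ (v · A) v A ⟩
        ((v · A) · A) ⊕ (v · A)  ≡⟨ cong (_⊕ (v · A)) (normZero-·A² v0) ⟩
        (v ⊕ (v · A)) ⊕ (v · A)  ≡⟨ solve ((var (# 0) ⊞ var (# 1)) ⊞ var (# 1)) (var (# 0)) (v ∷ v · A ∷ []) refl ⟩
        v                        ∎
        where open ≡-Reasoning

  pair-spanStable : ∀ {k} {b : Vec V k} {v} → SpanStable b → NormZero v → SpanStable (v ∷ v · A ∷ b)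
  pair-spanStable {b = b} {v} inv v0 =
    span-lookup (v ∷ v · A ∷ b) (# 1) ∷
    subst (InSpan (v ∷ v · A ∷ b)) (sym (normZero-·A² v0))
          (span-⊕ (span-lookup (v ∷ v · A ∷ b) (# 0)) (span-lookup (v ∷ v · A ∷ b) (# 1))) ∷
    All.map (span-∷ v ∘ span-∷ (v · A)) inv

  record Completion {f} (us : Vec V f) : Set where
    field
      pairs       : ℕ
      heads       : Vec V pairs
      normZero    : All NormZero heads
      independent : LinIndep (pairBasis heads ++ us)
      spanning    : ∀ u → InSpan (pairBasis heads ++ us) u

  complete : ∀ m {p f} (ws : Vec V p) (us : Vec V f) → m + (p *ℕ 2 + f) ≡ 7 → All NormZero ws →
             LinIndep (pairBasis ws ++ us) → SpanStable (pairBasis ws ++ us) →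
             (∀ u → Fixed u → InSpan (pairBasis ws ++ us) u) → Completion us
  complete m {p} {f} ws us eq ws0 indep inv fixed⊆ =
    step (∃? (λ v → NormZero? v ×-dec ¬? (InSpan? b v)))
    where
    b : Vec V (p *ℕ 2 + f)
    b = pairBasis ws ++ us
    step : Dec (∃ λ v → NormZero v × ¬ InSpan b v) → Completion us
    step (no none) = record { heads = ws ; normZero = ws0 ; independent = indep ; spanning = spanning }
      where
      spanning : ∀ u → InSpan b u
      spanning u = subst (InSpan b) (norm⊕trace u)
        (span-⊕ (fixed⊆ _ (norm-fixed u))
                (decidable-stable (InSpan? b (trace u)) λ t∉ → none (trace u , normZero-trace u , t∉)))
    step (yes (v , v0 , v∉)) = grow m eq (room-for-pair m _ eq (linIndep⇒≤7 indep′))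
      where
      indep′ : LinIndep (v ∷ v · A ∷ b)
      indep′ = pair-linIndep indep inv v0 v∉
      grow : ∀ m → m + (p *ℕ 2 + f) ≡ 7 → 2 ≤ m → Completion us
      grow (suc zero)    _  (s≤s ())
      grow (suc (suc m)) eq _ =
        complete m (v ∷ ws) us (trans (shift m _) eq) (v0 ∷ ws0) indep′ (pair-spanStable inv v0)
                 (λ u fu → span-∷ v (span-∷ (v · A) (fixed⊆ u fu)))
        where
        shift : ∀ m n → m + suc (suc n) ≡ suc (suc (m + n))
        shift m n = trans (ℕ.+-suc m (suc n)) (cong suc (ℕ.+-suc m n))

  completion : (fixed : MaximalFamily Fixed) → Completion (MaximalFamily.family fixed)
  completion fixed = complete (7 ∸ size) [] family (ℕ.m∸n+n≡m (linIndep⇒≤7 independent)) []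
                              independent (fixed⇒spanStable members) spans
    where open MaximalFamily fixed

  private
    row : ∀ {n} (ρ : Vec V n) {x} (e : Expr n) → x ≡ ⟦ e ⟧ ρ → x ≡ lincomb (normal e) ρ
    row ρ e eq = trans eq (⟦⟧≡lincomb-normal e ρ)

  M₁-form : ∀ {w₁ w₂ w₃ u} → NormZero w₁ → NormZero w₂ → NormZero w₃ → Fixed u →
            let P = pairBasis (w₁ ∷ w₂ ∷ w₃ ∷ []) ++ u ∷ [] in P * A ≡ M₁ * P
  M₁-form {w₁} {w₂} {w₃} {u} n₁ n₂ n₃ fu = ≡-by-lookup rows
    where
    P : Mat
    P = pairBasis (w₁ ∷ w₂ ∷ w₃ ∷ []) ++ u ∷ []
    rows : ∀ i → lookup (P * A) i ≡ lookup (M₁ * P) i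
    rows zero                                     = row P (var (# 1)) refl
    rows (suc zero)                               = row P (var (# 0) ⊞ var (# 1)) (normZero-·A² n₁)
    rows (suc (suc zero))                         = row P (var (# 3)) refl
    rows (suc (suc (suc zero)))                   = row P (var (# 2) ⊞ var (# 3)) (normZero-·A² n₂)
    rows (suc (suc (suc (suc zero))))             = row P (var (# 5)) refl
    rows (suc (suc (suc (suc (suc zero)))))       = row P (var (# 4) ⊞ var (# 5)) (normZero-·A² n₃)
    rows (suc (suc (suc (suc (suc (suc zero)))))) = row P (var (# 6)) fu

  M₂-form : ∀ {w₁ w₂ u₁ u₂ u₃} → NormZero w₁ → NormZero w₂ → Fixed u₁ → Fixed u₂ → Fixed u₃ →
            let P = pairBasis (w₁ ∷ w₂ ∷ []) ++ u₁ ∷ u₂ ∷ u₃ ∷ [] in P * A ≡ M₂ * P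
  M₂-form {w₁} {w₂} {u₁} {u₂} {u₃} n₁ n₂ f₁ f₂ f₃ = ≡-by-lookup rows
    where
    P : Mat
    P = pairBasis (w₁ ∷ w₂ ∷ []) ++ u₁ ∷ u₂ ∷ u₃ ∷ []
    rows : ∀ i → lookup (P * A) i ≡ lookup (M₂ * P) i
    rows zero                                     = row P (var (# 1)) refl
    rows (suc zero)                               = row P (var (# 0) ⊞ var (# 1)) (normZero-·A² n₁)
    rows (suc (suc zero))                         = row P (var (# 3)) refl
    rows (suc (suc (suc zero)))                   = row P (var (# 2) ⊞ var (# 3)) (normZero-·A² n₂)
    rows (suc (suc (suc (suc zero))))             = row P (var (# 4)) f₁
    rows (suc (suc (suc (suc (suc zero)))))       = row P (var (# 5)) f₂
    rows (suc (suc (suc (suc (suc (suc zero)))))) = row P (var (# 6)) f₃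

  M₃-form : ∀ {w u₁ u₂ u₃ u₄ u₅} → NormZero w → Fixed u₁ → Fixed u₂ → Fixed u₃ → Fixed u₄ → Fixed u₅ →
            let P = pairBasis (w ∷ []) ++ u₁ ∷ u₂ ∷ u₃ ∷ u₄ ∷ u₅ ∷ [] in P * A ≡ M₃ * P
  M₃-form {w} {u₁} {u₂} {u₃} {u₄} {u₅} n f₁ f₂ f₃ f₄ f₅ = ≡-by-lookup rows
    where
    P : Mat
    P = pairBasis (w ∷ []) ++ u₁ ∷ u₂ ∷ u₃ ∷ u₄ ∷ u₅ ∷ []
    rows : ∀ i → lookup (P * A) i ≡ lookup (M₃ * P) i
    rows zero                                     = row P (var (# 1)) refl
    rows (suc zero)                               = row P (var (# 0) ⊞ var (# 1)) (normZero-·A² n)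
    rows (suc (suc zero))                         = row P (var (# 2)) f₁
    rows (suc (suc (suc zero)))                   = row P (var (# 3)) f₂
    rows (suc (suc (suc (suc zero))))             = row P (var (# 4)) f₃
    rows (suc (suc (suc (suc (suc zero)))))       = row P (var (# 5)) f₄
    rows (suc (suc (suc (suc (suc (suc zero)))))) = row P (var (# 6)) f₅

  all-fixed⇒≡I : (∀ v → Fixed v) → A ≡ I
  all-fixed⇒≡I fixed = trans (sym (*-identityˡ A)) (trans (Vec.map-cong fixed I) (Vec.map-id I))

  classify : A ≢ I → ∀ {p f} (ws : Vec V p) (us : Vec V f) → p *ℕ 2 + f ≡ 7 → All NormZero ws → All Fixed us →
             LinIndep (pairBasis ws ++ us) → (∀ u → InSpan (pairBasis ws ++ us) u) →
             Similar A M₁ ⊎ Similar A M₂ ⊎ Similar A M₃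
  classify A≢I [] us refl [] us-fixed _ spans = ⊥-elim (A≢I (all-fixed⇒≡I λ v → span-fixed us-fixed (spans v)))
  classify A≢I (w ∷ []) (u₁ ∷ u₂ ∷ u₃ ∷ u₄ ∷ u₅ ∷ []) refl (n ∷ []) (f₁ ∷ f₂ ∷ f₃ ∷ f₄ ∷ f₅ ∷ []) indep _ =
    inj₂ (inj₂ (_ , indep , M₃-form n f₁ f₂ f₃ f₄ f₅))
  classify A≢I (w₁ ∷ w₂ ∷ []) (u₁ ∷ u₂ ∷ u₃ ∷ []) refl (n₁ ∷ n₂ ∷ []) (f₁ ∷ f₂ ∷ f₃ ∷ []) indep _ =
    inj₂ (inj₁ (_ , indep , M₂-form n₁ n₂ f₁ f₂ f₃))
  classify A≢I (w₁ ∷ w₂ ∷ w₃ ∷ []) (u ∷ []) refl (n₁ ∷ n₂ ∷ n₃ ∷ []) (f ∷ []) indep _ =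
    inj₁ (_ , indep , M₁-form n₁ n₂ n₃ f)
  classify A≢I (_ ∷ _ ∷ _ ∷ _ ∷ _) _ () _ _ _ _

  normal-form : A ≢ I → Similar A M₁ ⊎ Similar A M₂ ⊎ Similar A M₃
  normal-form A≢I =
    classify A≢I heads family (ℕ.≤-antisym (linIndep⇒≤7 independent) (spanning⇒≥7 spanning))
             normZero members independent spanning
    where
    fixed : MaximalFamily Fixed
    fixed = maximalFamily Fixed?
    open MaximalFamily fixed using (family; members)
    open Completion (completion fixed)

-- The geometry of M₃

unit : Fin 7 → V
unit = lookup I

-- F is the fixed space of M₃ and G a complement rotated by M₃; H is a hyperplane of F and O = F ∖ H.
Gbasis : Vec V 2
Gbasis = unit (# 0) ∷ unit (# 1) ∷ []

Hbasis : Vec V 4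
Hbasis = unit (# 3) ∷ unit (# 4) ∷ unit (# 5) ∷ unit (# 6) ∷ []

Fbasis : Vec V 5
Fbasis = unit (# 2) ∷ Hbasis

InG InH InF InO : V → Set
InG = InSpan Gbasis
InH = InSpan Hbasis
InF = InSpan Fbasis
InO x = InF x × ¬ InH x

InH? : ∀ x → Dec (InH x)
InH? = InSpan? Hbasis

InF? : ∀ x → Dec (InF x)
InF? = InSpan? Fbasis

H⊆F : ∀ {x} → InH x → InF x
H⊆F = span-∷ (unit (# 2))

O⊕H⊆O : ∀ {x h} → InO x → InH h → InO (x ⊕ h)
O⊕H⊆O {x} {h} (x∈F , x∉H) h∈H = span-⊕ x∈F (H⊆F h∈H) , λ x⊕h∈H →
  x∉H (subst InH (solve ((var (# 0) ⊞ var (# 1)) ⊞ var (# 1)) (var (# 0)) (x ∷ h ∷ []) refl) (span-⊕ x⊕h∈H h∈H))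

F∩G≡0 : ∀ x → InF x → InG x → x ≡ zeroV
F∩G≡0 = by-exhaustion λ x → InF? x →-dec (InSpan? Gbasis x →-dec (x ≟ᵥ zeroV))

M₃-fixes-F : ∀ {x} → InF x → x · M₃ ≡ x
M₃-fixes-F (c , refl) = lincomb-· c Fbasis M₃

moved : V → V
moved x = x ⊕ (x · M₃)

moved∈G : ∀ x → InG (moved x) × InG (moved x · M₃)
moved∈G = by-exhaustion λ x → InSpan? Gbasis (moved x) ×-dec InSpan? Gbasis (moved x · M₃)

moved-linIndep : ∀ x → ¬ InF x → LinIndep (moved x ∷ moved x · M₃ ∷ [])
moved-linIndep = by-exhaustion λ x → ¬? (InF? x) →-dec LinIndep? (moved x ∷ moved x · M₃ ∷ [])

O-prefix : ∀ x → InO x → take 3 x ≡ false ∷ false ∷ true ∷ []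
O-prefix = by-exhaustion λ x → (InF? x ×-dec ¬? (InH? x)) →-dec (take 3 x ≟ᵥ false ∷ false ∷ true ∷ [])

linIndep-Hbasis : LinIndep Hbasis
linIndep-Hbasis = toWitness {a? = LinIndep? Hbasis} _

Hbasis-nonzero : All (_≢ zeroV) Hbasis
Hbasis-nonzero = (λ ()) ∷ (λ ()) ∷ (λ ()) ∷ (λ ()) ∷ []

five-in-H-dependent : ∀ {b : Vec V 5} → All InH b → ¬ LinIndep b
five-in-H-dependent b⊆H indep = 5≰4 (steinitz indep b⊆H)
  where
  5≰4 : ¬ (5 ≤ 4)
  5≰4 (s≤s (s≤s (s≤s (s≤s ()))))

O-drop-injective : ∀ {x y} → InO x → InO y → drop 3 x ≡ drop 3 y → x ≡ y
O-drop-injective {x} {y} x∈O y∈O eq = begin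
  x                     ≡⟨ sym (Vec.take++drop≡id 3 x) ⟩
  take 3 x ++ drop 3 x  ≡⟨ cong₂ _++_ (trans (O-prefix x x∈O) (sym (O-prefix y y∈O))) eq ⟩
  take 3 y ++ drop 3 y  ≡⟨ Vec.take++drop≡id 3 y ⟩
  y                     ∎
  where open ≡-Reasoning

IsFan : V → Vec V 5 → Set
IsFan q as = (∀ i → InH (lookup as i)) × (∀ i → LinIndep (q ∷ lookup as i ∷ [])) ×
             (∀ i j → i ≢ j → LinIndep (q ∷ lookup as i ∷ lookup as j ∷ []))

IsFan? : ∀ q as → Dec (IsFan q as)
IsFan? q as = Fin.all? (λ i → InH? (lookup as i)) ×-dec Fin.all? (λ i → LinIndep? (q ∷ lookup as i ∷ [])) ×-dec
              Fin.all? (λ i → Fin.all? λ j → ¬? (i Fin.≟ j) →-dec LinIndep? (q ∷ lookup as i ∷ lookup as j ∷ []))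

first-in-H : {P : V → Set} → (∀ v → Dec (P v)) → V
first-in-H P? with ∃? (λ c → P? (lincomb c Hbasis))
... | yes (c , _) = lincomb c Hbasis
... | no  _       = zeroV

-- Each spoke is chosen greedily outside the planes spanned by q and the earlier spokes.
spokes : V → Vec V 5
spokes q = a₀ ∷ a₁ ∷ a₂ ∷ a₃ ∷ a₄ ∷ []
  where
  next : ∀ {k} → Vec V k → V
  next earlier = first-in-H λ a → ¬? (InSpan? (q ∷ []) a) ×-dec All.all? (λ p → ¬? (InSpan? (q ∷ p ∷ []) a)) earlier
  a₀ a₁ a₂ a₃ a₄ : V
  a₀ = next []
  a₁ = next (a₀ ∷ [])
  a₂ = next (a₀ ∷ a₁ ∷ [])
  a₃ = next (a₀ ∷ a₁ ∷ a₂ ∷ [])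
  a₄ = next (a₀ ∷ a₁ ∷ a₂ ∷ a₃ ∷ [])

fan : ∀ q → InH q × q ≢ zeroV → IsFan q (spokes q)
fan = by-exhaustion λ q → (InH? q ×-dec ¬? (q ≟ᵥ zeroV)) →-dec IsFan? q (spokes q)

-- No q-Fano plane is invariant under M₃

LinIndep₂ : V → V → Set
LinIndep₂ a b = LinIndep (a ∷ b ∷ [])

-- The blocks of an A-invariant q-Fano plane in coordinates where A acts as M₃: Block l is the block
-- through the line spanned by the independent pair l.
record BlockSystem : Set₁ where
  field
    Block   : ∀ {a b} → LinIndep₂ a b → V → Set
    Block?  : ∀ {a b} (l : LinIndep₂ a b) x → Dec (Block l x)
    ∋-left  : ∀ {a b} (l : LinIndep₂ a b) → Block l a
    ∋-right : ∀ {a b} (l : LinIndep₂ a b) → Block l b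
    ∋-⊕     : ∀ {a b} (l : LinIndep₂ a b) {x y} → Block l x → Block l y → Block l (x ⊕ y)
    dim≤3   : ∀ {a b} (l : LinIndep₂ a b) {c : Vec V 4} → All (Block l) c → ¬ LinIndep c
    dim≥3   : ∀ {a b} (l : LinIndep₂ a b) → ∃ λ z → Block l z × ¬ InSpan (a ∷ b ∷ []) z
    unique  : ∀ {a b c d x y} (l : LinIndep₂ a b) (l′ : LinIndep₂ c d) → LinIndep₂ x y →
              Block l x → Block l y → Block l′ x → Block l′ y → ∀ u → Block l u → Block l′ u
    fixed   : ∀ {a b} (l : LinIndep₂ a b) → InF a → InF b → ∀ x → Block l x → InF x

module Blocks (blocks : BlockSystem) where

  open BlockSystem blocks

  ∋-zeroV : ∀ {a b} (l : LinIndep₂ a b) → Block l zeroV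
  ∋-zeroV {a} l = subst (Block l) (⊕-self a) (∋-⊕ l (∋-left l) (∋-left l))

  ∋-lincomb : ∀ {a b k} (l : LinIndep₂ a b) {vs : Vec V k} → All (Block l) vs → ∀ c → Block l (lincomb c vs)
  ∋-lincomb l []       []      = ∋-zeroV l
  ∋-lincomb l (p ∷ ps) (x ∷ c) = ∋-⊕ l (∋-scale x p) (∋-lincomb l ps c)
    where
    ∋-scale : ∀ x {u} → Block l u → Block l (scale x u)
    ∋-scale true  p = subst (Block l) (sym (scale-true _)) p
    ∋-scale false p = subst (Block l) (sym (scale-false _)) (∋-zeroV l)

  basis : ∀ {a b} (l : LinIndep₂ a b) → ∃ λ z → LinIndep (z ∷ a ∷ b ∷ []) × All (Block l) (z ∷ a ∷ b ∷ [])
  basis l = let z , z∈ , z∉ = dim≥3 l in z , linIndep-∷ l z∉ , z∈ ∷ ∋-left l ∷ ∋-right l ∷ []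

  InsideH : ∀ {a b} → LinIndep₂ a b → Set
  InsideH l = ∀ x → Block l x → InH x

  InsideH? : ∀ {a b} (l : LinIndep₂ a b) → Dec (InsideH l)
  InsideH? l = ∀? λ x → Block? l x →-dec InH? x

  escape : ∀ {a b} (l : LinIndep₂ a b) → ¬ InsideH l → ∃ λ z → Block l z × ¬ InH z
  escape l l⊈H = decidable-stable (∃? λ z → Block? l z ×-dec ¬? (InH? z))
    λ none → l⊈H λ x x∈ → decidable-stable (InH? x) λ x∉H → none (x , x∈ , x∉H)

  module _ {q} (q∈H : InH q) (q≢0 : q ≢ zeroV) where

    private
      spoke : Fin 5 → V
      spoke = lookup (spokes q)
      spoke∈H : ∀ i → InH (spoke i)
      spoke∈H = proj₁ (fan q (q∈H , q≢0))
      line : ∀ i → LinIndep₂ q (spoke i)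
      line = proj₁ (proj₂ (fan q (q∈H , q≢0)))
      spokes-independent : ∀ i j → i ≢ j → LinIndep (q ∷ spoke i ∷ spoke j ∷ [])
      spokes-independent = proj₂ (proj₂ (fan q (q∈H , q≢0)))

      no-shared-O-point : ∀ {i j y} → i ≢ j → InO y → Block (line i) y → Block (line j) y → ⊥
      no-shared-O-point {i} {j} {y} i≢j (_ , y∉H) y∈i y∈j = dim≤3 (line i) all-in independent
        where
        q-y : LinIndep₂ q y
        q-y = linIndep-pair q≢0 (λ y≡0 → y∉H (subst InH (sym y≡0) (span-zeroV Hbasis)))
                                (λ q≡y → y∉H (subst InH q≡y q∈H))
        spoke-j∈i : Block (line i) (spoke j)
        spoke-j∈i = unique (line j) (line i) q-y (∋-left (line j)) y∈j (∋-left (line i)) y∈i _ (∋-right (line j))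
        all-in : All (Block (line i)) (y ∷ q ∷ spoke i ∷ spoke j ∷ [])
        all-in = y∈i ∷ ∋-left (line i) ∷ ∋-right (line i) ∷ spoke-j∈i ∷ []
        independent : LinIndep (y ∷ q ∷ spoke i ∷ spoke j ∷ [])
        independent = linIndep-∷ (spokes-independent i j i≢j)
          λ y∈span → y∉H (span-⊆ (q∈H ∷ spoke∈H i ∷ spoke∈H j ∷ []) y∈span)

      -- If no block through q and a spoke lies in H, each contains four points of O, and these twenty
      -- points are distinct; but |O| = 16.
      escaping-impossible : (∀ i → ∃ λ z → Block (line i) z × ¬ InH z) → ⊥
      escaping-impossible escapes = 20≰16 (indexed-injective⇒≤ (λ i s → drop 3 (point i s)) drop-injective)
        where
        20≰16 : ¬ (20 ≤ 16)
        20≰16 = toWitnessFalse {a? = 20 ℕ.≤? 16} _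
        z : Fin 5 → V
        z i = proj₁ (escapes i)
        z∈O : ∀ i → InO (z i)
        z∈O i = let _ , z∈block , z∉H = escapes i in fixed (line i) (H⊆F q∈H) (H⊆F (spoke∈H i)) _ z∈block , z∉H
        point : Fin 5 → Vec Bool 2 → V
        point i s = z i ⊕ lincomb s (q ∷ spoke i ∷ [])
        point∈O : ∀ i s → InO (point i s)
        point∈O i s = O⊕H⊆O (z∈O i) (span-lincomb (q∈H ∷ spoke∈H i ∷ []) s)
        point∈block : ∀ i s → Block (line i) (point i s)
        point∈block i s = ∋-⊕ (line i) (proj₁ (proj₂ (escapes i)))
                               (∋-lincomb (line i) (∋-left (line i) ∷ ∋-right (line i) ∷ []) s)
        point-injective : ∀ i s j t → point i s ≡ point j t → i ≡ j × s ≡ t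
        point-injective i s j t eq = case (i Fin.≟ j)
          where
          case : Dec (i ≡ j) → i ≡ j × s ≡ t
          case (yes i≡j) = i≡j , lincomb-injective (line j) s t
                                   (⊕-cancelˡ (z j) (subst (λ k → point k s ≡ point j t) i≡j eq))
          case (no  i≢j) = ⊥-elim (no-shared-O-point i≢j (point∈O i s) (point∈block i s)
                                                         (subst (Block (line j)) (sym eq) (point∈block j t)))
        drop-injective : ∀ i s j t → drop 3 (point i s) ≡ drop 3 (point j t) → i ≡ j × s ≡ t
        drop-injective i s j t eq = point-injective i s j t (O-drop-injective (point∈O i s) (point∈O j t) eq)

      decide : Dec (∃ λ i → InsideH (line i)) → ∃ λ a → Σ (LinIndep₂ q a) InsideH
      decide (yes (i , inside)) = spoke i , line i , inside
      decide (no  none)         = ⊥-elim (escaping-impossible λ i → escape (line i) λ inside → none (i , inside))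

    block-in-H : ∃ λ a → Σ (LinIndep₂ q a) InsideH
    block-in-H = decide (Fin.any? λ i → InsideH? (line i))

  module _ {a₁ b₁ a₂ b₂} (l₁ : LinIndep₂ a₁ b₁) (l₂ : LinIndep₂ a₂ b₂) (inside₁ : InsideH l₁) (inside₂ : InsideH l₂) where

    private
      β₁ β₂ : Vec V 3
      β₁ = proj₁ (basis l₁) ∷ a₁ ∷ b₁ ∷ []
      β₂ = proj₁ (basis l₂) ∷ a₂ ∷ b₂ ∷ []
      β₁-indep : LinIndep β₁
      β₁-indep = proj₁ (proj₂ (basis l₁))
      β₂-indep : LinIndep β₂
      β₂-indep = proj₁ (proj₂ (basis l₂))
      β₁∈block : All (Block l₁) β₁
      β₁∈block = proj₂ (proj₂ (basis l₁))
      β₂∈block : All (Block l₂) β₂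
      β₂∈block = proj₂ (proj₂ (basis l₂))

      Meet : Fin 3 → Set
      Meet p = Σ (Vec Bool 3) λ c → c ≢ zeros 3 × lookup c p ≡ false × Block l₁ (lincomb c β₂)

      -- β₁ together with β₂ minus its p-th vector are five vectors of H; a relation among them gives the meet.
      meet : ∀ p → Meet p
      meet p = from-relation (¬linIndep⇒relation (five-in-H-dependent (++⁺ (All.map (inside₁ _) β₁∈block) (All-removeAt (All.map (inside₂ _) β₂∈block) p))))
        where
        from-relation : (Σ (Vec Bool 5) λ c → lincomb c (β₁ ++ removeAt β₂ p) ≡ zeroV × c ≢ zeros 5) → Meet p
        from-relation (d₁ ∷ d₂ ∷ d₃ ∷ e₁ ∷ e₂ ∷ [] , relation , nonzero) =
          c , c≢0 , Vec.insertAt-lookup e p false , subst (Block l₁) same (∋-lincomb l₁ β₁∈block d)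
          where
          d : Vec Bool 3
          d = d₁ ∷ d₂ ∷ d₃ ∷ []
          e : Vec Bool 2
          e = e₁ ∷ e₂ ∷ []
          c = insertAt e p false
          same : lincomb d β₁ ≡ lincomb c β₂
          same = trans (⊕≡zeros⇒≡ _ _ (trans (sym (lincomb-++ d e β₁ (removeAt β₂ p))) relation))
                       (sym (lincomb-insertAt e β₂ p))
          c≢0 : c ≢ zeros 3
          c≢0 c≡0 = nonzero (cong₂ _++_ (β₁-indep d (trans same (trans (cong (λ c → lincomb c β₂) c≡0) (lincomb-zeros β₂))))
                                        (insertAt-false≡zeros e p c≡0))

      c : Fin 3 → Vec Bool 3
      c p = proj₁ (meet p)

      r : Fin 3 → V
      r p = lincomb (c p) β₂

      through-distinct : ∀ p p′ → r p ≢ r p′ → ∀ u → Block l₂ u → Block l₁ u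
      through-distinct p p′ r≢r′ = unique l₂ l₁ (linIndep-pair (r≢0 p) (r≢0 p′) r≢r′)
        (∋-lincomb l₂ β₂∈block (c p)) (∋-lincomb l₂ β₂∈block (c p′)) (r∈₁ p) (r∈₁ p′)
        where
        r≢0 : ∀ p → r p ≢ zeroV
        r≢0 p r≡0 = proj₁ (proj₂ (meet p)) (β₂-indep (c p) r≡0)
        r∈₁ : ∀ p → Block l₁ (r p)
        r∈₁ p = proj₂ (proj₂ (proj₂ (meet p)))

      -- r₀ = r₁ = r₂ would be a combination of β₂ with every coefficient zero.
      some-distinct : Dec (r (# 0) ≡ r (# 1)) → Dec (r (# 0) ≡ r (# 2)) → ∀ u → Block l₂ u → Block l₁ u
      some-distinct (no  r₀≢r₁) _            = through-distinct (# 0) (# 1) r₀≢r₁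
      some-distinct (yes _)     (no  r₀≢r₂) = through-distinct (# 0) (# 2) r₀≢r₂
      some-distinct (yes r₀≡r₁) (yes r₀≡r₂) = ⊥-elim (proj₁ (proj₂ (meet (# 0))) (≡-by-lookup coefficient≡false))
        where
        avoids : ∀ p → lookup (c p) p ≡ false
        avoids p = proj₁ (proj₂ (proj₂ (meet p)))
        same-coefficients : ∀ p → r (# 0) ≡ r p → c (# 0) ≡ c p
        same-coefficients p = lincomb-injective β₂-indep (c (# 0)) (c p)
        coefficient≡false : ∀ p → lookup (c (# 0)) p ≡ lookup (zeros 3) p
        coefficient≡false zero             = avoids (# 0)
        coefficient≡false (suc zero)       = trans (cong (λ d → lookup d (# 1)) (same-coefficients (# 1) r₀≡r₁)) (avoids (# 1))
        coefficient≡false (suc (suc zero)) = trans (cong (λ d → lookup d (# 2)) (same-coefficients (# 2) r₀≡r₂)) (avoids (# 2))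

    blocks-in-H-nested : ∀ u → Block l₂ u → Block l₁ u
    blocks-in-H-nested = some-distinct (r (# 0) ≟ᵥ r (# 1)) (r (# 0) ≟ᵥ r (# 2))

  impossible : ⊥
  impossible = second-block (∃? λ q → InH? q ×-dec ¬? (q ≟ᵥ zeroV) ×-dec ¬? (Block? l₁ q))
    where
    first : ∃ λ a → Σ (LinIndep₂ (unit (# 3)) a) InsideH
    first = block-in-H (span-lookup Hbasis (# 0)) (λ ())
    l₁ : LinIndep₂ (unit (# 3)) (proj₁ first)
    l₁ = proj₁ (proj₂ first)
    inside₁ : InsideH l₁
    inside₁ = proj₂ (proj₂ first)
    second-block : Dec (∃ λ q → InH q × q ≢ zeroV × ¬ Block l₁ q) → ⊥
    second-block (yes (q , q∈H , q≢0 , q∉₁)) =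
      let _ , l₂ , inside₂ = block-in-H q∈H q≢0 in q∉₁ (blocks-in-H-nested l₁ l₂ inside₁ inside₂ q (∋-left l₂))
    second-block (no  none) = dim≤3 l₁ (lookup⁻ Hbasis⊆block) linIndep-Hbasis
      where
      Hbasis⊆block : ∀ i → Block l₁ (lookup Hbasis i)
      Hbasis⊆block i = decidable-stable (Block? l₁ _)
        λ ∉₁ → none (_ , span-lookup Hbasis i , lookup⁺ Hbasis-nonzero i , ∉₁)

module Pullback {D : Subset → Set} (fano : IsQFano D) {A P : Mat} (invariant : Invariant D A)
                (P-indep : LinIndep P) (similar : P * A ≡ M₃ * P) where

  open Equivalence

  private
    dim3 : ∀ S → D S → HasDim S 3
    dim3 = proj₁ (proj₂ fano)
    on-lines : ∀ T → HasDim T 2 → Σ Subset λ S → D S × T ⊆ S × (∀ S′ → D S′ → T ⊆ S′ → S′ ≐ S)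
    on-lines = proj₂ (proj₂ fano)

  φ : V → V
  φ x = x · P

  φ-linIndep : ∀ {k} {b : Vec V k} → LinIndep b → LinIndep (map φ b)
  φ-linIndep {b = b} indep c eq =
    indep c (lincomb-injective P-indep _ _ (trans (lincomb-· c b P) (trans eq (sym (zeroV-· P)))))

  φ-·A : ∀ x → φ x · A ≡ φ (x · M₃)
  φ-·A x = trans (sym (·-* x P A)) (trans (cong (x ·_) similar) (·-* x M₃ P))

  module Member {S : Subset} (S∈D : D S) where

    private
      β : Vec V 3
      β = proj₁ (dim3 S S∈D)
      β-indep : LinIndep β
      β-indep = proj₁ (proj₂ (dim3 S S∈D))
      S≐span : S ≐ InSpan β
      S≐span = proj₂ (proj₂ (dim3 S S∈D))

    S? : ∀ u → Dec (S u)
    S? u = map′ (from (S≐span u)) (to (S≐span u)) (InSpan? β u)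

    S-lincomb : ∀ {k} {vs : Vec V k} → All S vs → ∀ c → S (lincomb c vs)
    S-lincomb vs⊆S c = from (S≐span _) (span-lincomb (All.map (to (S≐span _)) vs⊆S) c)

    S-⊕ : ∀ {u v} → S u → S v → S (u ⊕ v)
    S-⊕ u∈S v∈S = from (S≐span _) (span-⊕ (to (S≐span _) u∈S) (to (S≐span _) v∈S))

    S-dim≤3 : ∀ {c : Vec V 4} → All S c → ¬ LinIndep c
    S-dim≤3 c⊆S indep = 4≰3 (steinitz indep (All.map (to (S≐span _)) c⊆S))
      where
      4≰3 : ¬ (4 ≤ 3)
      4≰3 (s≤s (s≤s (s≤s ())))

    S-basis : Σ (Vec V 3) λ β → LinIndep β × All S β
    S-basis = β , β-indep , lookup⁻ λ i → from (S≐span _) (span-lookup β i)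

  Line : V → V → Subset
  Line a b = InSpan (φ a ∷ φ b ∷ [])

  block : ∀ {a b} → LinIndep₂ a b → Σ Subset λ S → D S × Line a b ⊆ S × (∀ S′ → D S′ → Line a b ⊆ S′ → S′ ≐ S)
  block {a} {b} l = on-lines (Line a b) ((φ a ∷ φ b ∷ []) , φ-linIndep l , λ _ → mk⇔ (λ p → p) (λ p → p))

  module _ {a b} (l : LinIndep₂ a b) where
    S : Subset
    S = proj₁ (block l)
    S∈D : D S
    S∈D = proj₁ (proj₂ (block l))
    Line⊆S : Line a b ⊆ S
    Line⊆S = proj₁ (proj₂ (proj₂ (block l)))
    S-unique : ∀ S′ → D S′ → Line a b ⊆ S′ → S′ ≐ S
    S-unique = proj₂ (proj₂ (proj₂ (block l)))
    open Member S∈D public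

  Block : ∀ {a b} → LinIndep₂ a b → V → Set
  Block l x = S l (φ x)

  private
    Q : Mat
    Q = proj₁ (linIndep⇒invertible P-indep)

    φ-·Q : ∀ x → φ (x · Q) ≡ x
    φ-·Q x = trans (sym (·-* x Q P)) (trans (cong (x ·_) (proj₂ (proj₂ (linIndep⇒invertible P-indep)))) (·-identityʳ x))

    Line⊆ : ∀ {a b} (l : LinIndep₂ a b) x y → Block l x → Block l y → Line x y ⊆ S l
    Line⊆ l x y x∈ y∈ _ (c , refl) = S-lincomb l (x∈ ∷ y∈ ∷ []) c

  dim≥3 : ∀ {a b} (l : LinIndep₂ a b) → ∃ λ z → Block l z × ¬ InSpan (a ∷ b ∷ []) z
  dim≥3 {a} {b} l = decidable-stable (∃? λ z → S? l (φ z) ×-dec ¬? (InSpan? (a ∷ b ∷ []) z))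
    λ none → 3≰2 (steinitz ys-indep (lookup⁻ λ i → decidable-stable (InSpan? _ _) λ ∉ → none (_ , ys∈S i , ∉)))
    where
    3≰2 : ¬ (3 ≤ 2)
    3≰2 (s≤s (s≤s ()))
    β : Vec V 3
    β = proj₁ (S-basis l)
    ys : Vec V 3
    ys = map (_· Q) β
    φ-ys : ∀ i → φ (lookup ys i) ≡ lookup β i
    φ-ys i = trans (cong φ (Vec.lookup-map i (_· Q) β)) (φ-·Q (lookup β i))
    ys∈S : ∀ i → Block l (lookup ys i)
    ys∈S i = subst (S l) (sym (φ-ys i)) (lookup⁺ (proj₂ (proj₂ (S-basis l))) i)
    ys-indep : LinIndep ys
    ys-indep c eq = proj₁ (proj₂ (S-basis l)) c (begin
      lincomb c β             ≡⟨ cong (lincomb c) (sym (≡-by-lookup λ i → trans (Vec.lookup-map i φ ys) (φ-ys i))) ⟩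
      lincomb c (map φ ys)    ≡⟨ sym (lincomb-· c ys P) ⟩
      lincomb c ys · P        ≡⟨ cong (_· P) eq ⟩
      zeroV · P               ≡⟨ zeroV-· P ⟩
      zeroV                   ∎)
      where open ≡-Reasoning

  unique : ∀ {a b c d x y} (l : LinIndep₂ a b) (l′ : LinIndep₂ c d) → LinIndep₂ x y →
           Block l x → Block l y → Block l′ x → Block l′ y → ∀ u → Block l u → Block l′ u
  unique {x = x} {y} l l′ xy x∈ y∈ x∈′ y∈′ u u∈ = from (l′≐xy (φ u)) (to (l≐xy (φ u)) u∈)
    where
    l≐xy : S l ≐ S xy
    l≐xy = S-unique xy (S l) (S∈D l) (Line⊆ l x y x∈ y∈)
    l′≐xy : S l′ ≐ S xy
    l′≐xy = S-unique xy (S l′) (S∈D l′) (Line⊆ l′ x y x∈′ y∈′)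

  -- A block through a line of F is mapped by A to a block through the same line, hence to itself.
  ·M₃-closed : ∀ {a b} (l : LinIndep₂ a b) → InF a → InF b → ∀ {w} → Block l w → Block l (w · M₃)
  ·M₃-closed {a} {b} l a∈F b∈F {w} w∈ = subst (S l) (φ-·A w) (to (image≐S (φ w · A)) (φ w , w∈ , refl))
    where
    image∈D : D (S l ▷ A)
    image∈D = from (invariant (S l ▷ A)) (S l , S∈D l , λ _ → mk⇔ (λ p → p) (λ p → p))
    fixes-line : map (_· A) (φ a ∷ φ b ∷ []) ≡ φ a ∷ φ b ∷ []
    fixes-line = cong₂ (λ x y → x ∷ y ∷ []) (trans (φ-·A a) (cong φ (M₃-fixes-F a∈F)))
                                            (trans (φ-·A b) (cong φ (M₃-fixes-F b∈F)))
    line⊆image : Line a b ⊆ (S l ▷ A)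
    line⊆image t (c , refl) = t , Line⊆S l t (c , refl) , trans (lincomb-· c _ A) (cong (lincomb c) fixes-line)
    image≐S : (S l ▷ A) ≐ S l
    image≐S = S-unique l (S l ▷ A) image∈D line⊆image

  fixed : ∀ {a b} (l : LinIndep₂ a b) → InF a → InF b → ∀ x → Block l x → InF x
  fixed {a} {b} l a∈F b∈F x x∈ = decidable-stable (InF? x) λ x∉F →
    S-dim≤3 l (map⁺ {xs = a ∷ b ∷ moved x ∷ moved x · M₃ ∷ []} (∋-left ∷ ∋-right ∷ y∈ ∷ ·M₃-closed l a∈F b∈F {moved x} y∈ ∷ []))
              (φ-linIndep (linIndep-++ l (moved-linIndep x x∉F) F∩moved≡0))
    where
    ∋-left : Block l a
    ∋-left = Line⊆S l (φ a) (span-lookup _ (# 0))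
    ∋-right : Block l b
    ∋-right = Line⊆S l (φ b) (span-lookup _ (# 1))
    y∈ : Block l (moved x)
    y∈ = subst (S l) (sym (·-⊕ x (x · M₃) P)) (S-⊕ l x∈ (·M₃-closed l a∈F b∈F {x} x∈))
    F∩moved≡0 : ∀ z → InSpan (a ∷ b ∷ []) z → InSpan (moved x ∷ moved x · M₃ ∷ []) z → z ≡ zeroV
    F∩moved≡0 z z∈ab z∈moved = F∩G≡0 z (span-⊆ (a∈F ∷ b∈F ∷ []) z∈ab) (span-⊆ (proj₁ (moved∈G x) ∷ proj₂ (moved∈G x) ∷ []) z∈moved)

  blocks : BlockSystem
  blocks = record
    { Block   = Block
    ; Block?  = λ l x → S? l (φ x)
    ; ∋-left  = λ l → Line⊆S l _ (span-lookup _ (# 0))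
    ; ∋-right = λ l → Line⊆S l _ (span-lookup _ (# 1))
    ; ∋-⊕     = λ l {x} {y} x∈ y∈ → subst (S l) (sym (·-⊕ x y P)) (S-⊕ l x∈ y∈)
    ; dim≤3   = λ l c⊆ indep → S-dim≤3 l (map⁺ {f = φ} c⊆) (φ-linIndep indep)
    ; dim≥3   = dim≥3
    ; unique  = unique
    ; fixed   = fixed
    }

M₃-excluded : ∀ {D A} → IsQFano D → Invariant D A → ¬ Similar A M₃
M₃-excluded fano invariant (P , P-indep , similar) = Blocks.impossible (Pullback.blocks fano invariant P-indep similar)

similar⇒conjugateToCyclic : ∀ {G M} (cyclic : CyclicOfOrder3 G) → Similar (CyclicOfOrder3.generator cyclic) M →
                            Σ Mat λ P → Σ Mat λ Q → (P * Q ≡ I) × (Q * P ≡ I) × ConjugateToCyclic G M P Q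
similar⇒conjugateToCyclic {M = M} cyclic (P , P-indep , PA≡MP) =
  P , Q , PQ≡I , QP≡I , conjugateToCyclic PQ≡I QP≡I cyclic QMP≡A
  where
  A : Mat
  A = CyclicOfOrder3.generator cyclic
  Q : Mat
  Q = proj₁ (linIndep⇒invertible P-indep)
  PQ≡I : P * Q ≡ I
  PQ≡I = proj₁ (proj₂ (linIndep⇒invertible P-indep))
  QP≡I : Q * P ≡ I
  QP≡I = proj₂ (proj₂ (linIndep⇒invertible P-indep))
  QMP≡A : Q * (M * P) ≡ A
  QMP≡A = begin
    Q * (M * P)  ≡⟨ cong (Q *_) (sym PA≡MP) ⟩
    Q * (P * A)  ≡⟨ sym (*-assoc Q P A) ⟩
    (Q * P) * A  ≡⟨ cong (_* A) QP≡I ⟩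
    I * A        ≡⟨ *-identityˡ A ⟩
    A            ∎
    where open ≡-Reasoning

lemma15 : (D : Subset → Set) (G : Mat → Set) →
  IsQFano D → IsSubgroupGL G → HasOrder3 G → (∀ A → G A → Invariant D A) →
    Σ Mat λ P → Σ Mat λ Q → (P * Q ≡ I) × (Q * P ≡ I) ×
      (ConjugateToCyclic G M₁ P Q ⊎ ConjugateToCyclic G M₂ P Q)
lemma15 D G fano subgroup order3 invariant = conclude (Order3.normal-form A A³≡I A≢I)
  where
  cyclic : CyclicOfOrder3 G
  cyclic = order3⇒cyclic subgroup order3
  open CyclicOfOrder3 cyclic renaming (generator to A; generator³ to A³≡I; generator≢I to A≢I)
  conclude : Similar A M₁ ⊎ Similar A M₂ ⊎ Similar A M₃ →
             Σ Mat λ P → Σ Mat λ Q → (P * Q ≡ I) × (Q * P ≡ I) × (ConjugateToCyclic G M₁ P Q ⊎ ConjugateToCyclic G M₂ P Q)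
  conclude (inj₁ similar₁) =
    let P , Q , PQ≡I , QP≡I , conj = similar⇒conjugateToCyclic {M = M₁} cyclic similar₁ in P , Q , PQ≡I , QP≡I , inj₁ conj
  conclude (inj₂ (inj₁ similar₂)) =
    let P , Q , PQ≡I , QP≡I , conj = similar⇒conjugateToCyclic {M = M₂} cyclic similar₂ in P , Q , PQ≡I , QP≡I , inj₂ conj
  conclude (inj₂ (inj₂ similar₃)) =
    ⊥-elim (M₃-excluded fano (invariant A (Equivalence.from (members A) (1 , sym (*-identityʳ A)))) similar₃)
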